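{- For every proper caterpillar $T$ and every $\beta\in\Phi(T)$, \[U^L_T(\mathbf{x})=\mathcal{L}(\beta,\mathbf{x}).\]
   Context: A composition of $n$ is a finite sequence $\beta=\beta_1\cdots\beta_k$ of positive integers summing to $n$; its reverse is $\beta_k\cdots\beta_1$ and $[\beta]^*=\{\beta,\text{reverse of }\beta\}$. A composition $\alpha$ is a coarsening of $\beta$, written $\alpha\succeq\beta$, if $\alpha$ is obtained from $\beta$ by summing blocks of consecutive components, i.e. there are indices $1=j_0<j_1<\cdots<j_i<j_{i+1}=k+1$ with $\alpha=(\beta_{j_0}+\cdots+\beta_{j_1-1})(\beta_{j_1}+\cdots+\beta_{j_2-1})\cdots(\beta_{j_i}+\cdots+\beta_{j_{i+1}-1})$. The type $\lambda(\alpha)$ of a composition is the partition obtained by sorting its components in weakly decreasing order. With commuting indeterminates $\mathbf{x}=x_1,x_2,\ldots$ and $\mathbf{x}_\lambda=x_{\lambda_1}\cdots x_{\lambda_l}$ for a partition $\lambda$, the composition-lattice polynomial is $\mathcal{L}(\beta,\mathbf{x})=\sum_{\alpha\succeq\beta}\mathbf{x}_{\lambda(\alpha)}$. For a tree $T=(V,E)$ and $A\subseteq E$, $\lambda(A)$ is the partition of $|V|$ given by the component sizes of the spanning subgraph $(V,A)$. A caterpillar is a tree whose internal vertices induce a non-trivial path (the spine); $L(T)$ is the set of edges not on the spine; $T$ is proper if every internal vertex is adjacent to a leaf. $U^L_T(\mathbf{x})=\sum_{A\subseteq E,\ L(T)\subseteq A}\mathbf{x}_{\lambda(A)}$. For a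 proper caterpillar with spine $v_1\cdots v_k$, $\Phi(T)=[\beta_1\cdots\beta_k]^*$ where $\beta_i$ is one plus the number of leaves adjacent to $v_i$. -}

module Defs where

open import Data.Nat using (ℕ; zero; suc; _+_; _≤_; _≤ᵇ_)
open import Data.Nat.Properties using (≤-decTotalOrder)
open import Data.Bool using (Bool; true; false; _∧_; _∨_; not)
open import Data.Fin using (Fin; toℕ; _≟_)
open import Data.List using (List; []; _∷_; [_]; map; _++_; filter; length; allFin; lookup)
open import Data.Bool.ListAction using (any; all)
open import Data.List.Membership.Propositional using (_∈_)
open import Data.List.Relation.Unary.Unique.Propositional using (Unique)
open import Data.Product using (_×_; _,_; Σ; ∃)
open import Data.Sum using (_⊎_)
open import Relation.Nullary using (¬_)
open import Relation.Nullary.Decidable using (⌊_⌋)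
open import Relation.Binary.PropositionalEquality using (_≡_)
open import Function.Bundles using (_⇔_)
import Data.List.Sort

-- A monomial x_λ = x_{λ_1} ⋯ x_{λ_l} is a commutative product, so it is
-- determined by the multiset of indices; we represent it canonically by
-- the sorted list of its indices.  A polynomial with coefficients in ℕ
-- which is a sum of such monomials is represented by the list of its
-- monomials (with repetition); two such polynomials are equal iff these
-- lists are permutations of each other (_↭_).

open Data.List.Sort ≤-decTotalOrder using (sort)

type : List ℕ → List ℕ
type α = sort α

-- all coarsenings of a composition β: for each gap between consecutive
-- components we either cut or merge (sum) the adjacent blocks.
coarsenings : List ℕ → List (List ℕ)
coarsenings [] = [ [] ]
coarsenings (b ∷ []) = [ b ∷ [] ]
coarsenings (b ∷ c ∷ rest) = map (b ∷_) (coarsenings (c ∷ rest)) ++ map (addHead b) (coarsenings (c ∷ rest))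
  where
  addHead : ℕ → List ℕ → List ℕ
  addHead b [] = [ b ]
  addHead b (a ∷ as) = (b + a) ∷ as

-- the composition-lattice polynomial  L(β,x) = Σ_{α ⪰ β} x_{λ(α)}
Lpoly : List ℕ → List (List ℕ)
Lpoly β = map type (coarsenings β)

-- Graphs on the vertex set Fin n, edges given as a list of (unordered) pairs

Edges : ℕ → Set
Edges n = List (Fin n × Fin n)

module _ {n : ℕ} where

  _==_ : Fin n → Fin n → Bool
  u == v = ⌊ u ≟ v ⌋

  Adj : Edges n → Fin n → Fin n → Set
  Adj E u v = (u , v) ∈ E ⊎ (v , u) ∈ E

  data Reach (E : Edges n) : Fin n → Fin n → Set where
    here : ∀ {u} → Reach E u u
    step : ∀ {u v w} → Adj E u v → Reach E v w → Reach E u w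

  Connected : Edges n → Set
  Connected E = ∀ u v → Reach E u v

  deg : Edges n → Fin n → ℕ
  deg E v = length (filter (λ e → ((v == Data.Product.proj₁ e) ∨ (v == Data.Product.proj₂ e)) Data.Bool.≟ true) E)

  Leaf : Edges n → Fin n → Set
  Leaf E v = deg E v ≡ 1

  Internal : Edges n → Fin n → Set
  Internal E v = 2 ≤ deg E v

  isInternal : Edges n → Fin n → Bool
  isInternal E v = 2 ≤ᵇ deg E v

  isLeaf : Edges n → Fin n → Bool
  isLeaf E v = ⌊ deg E v Data.Nat.≟ 1 ⌋

  leafCount : Edges n → Fin n → ℕ
  leafCount E v = length (filter (λ e → (((v == Data.Product.proj₁ e) ∧ isLeaf E (Data.Product.proj₂ e))
                                         ∨ ((v == Data.Product.proj₂ e) ∧ isLeaf E (Data.Product.proj₁ e))) Data.Bool.≟ true) E)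

  IsTree : Edges n → Set
  IsTree E = (1 ≤ n) × Connected E × (suc (length E) ≡ n)

  -- vs = v₁ ⋯ v_k is a listing of the internal vertices which induce the
  -- non-trivial path v₁ − v₂ − ⋯ − v_k  (k ≥ 2)
  IsSpine : Edges n → List (Fin n) → Set
  IsSpine E vs =
    (2 ≤ length vs) × Unique vs
    × (∀ v → v ∈ vs ⇔ Internal E v)
    × (∀ (i j : Fin (length vs)) →
         Adj E (lookup vs i) (lookup vs j) ⇔ ((suc (toℕ i) ≡ toℕ j) ⊎ (suc (toℕ j) ≡ toℕ i)))

  IsCaterpillar : Edges n → Set
  IsCaterpillar E = IsTree E × ∃ (IsSpine E)

  IsProper : Edges n → Set
  IsProper E = ∀ v → Internal E v → ∃ λ u → Leaf E u × Adj E v u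

  -- β ∈ Φ(T):  β = β₁ ⋯ β_k with β_i = 1 + #leaves adjacent to v_i for a
  -- listing v₁ ⋯ v_k of the spine (the two orientations give [β]*)
  InΦ : Edges n → List ℕ → Set
  InΦ E β = Σ (List (Fin n)) λ vs → IsSpine E vs × (β ≡ map (λ v → suc (leafCount E v)) vs)

  -- all sub(multi)sets of a list of edges (each subset once when the list
  -- has no repetitions)
  subsets : Edges n → List (Edges n)
  subsets [] = [ [] ]
  subsets (e ∷ es) = map (e ∷_) (subsets es) ++ subsets es

  edgeEq : Fin n × Fin n → Fin n × Fin n → Bool
  edgeEq (a , b) (c , d) = (a == c) ∧ (b == d)

  memB : Fin n × Fin n → Edges n → Bool
  memB e A = any (edgeEq e) A

  grow : Edges n → (Fin n → Bool) → (Fin n → Bool)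
  grow A S u = S u ∨ any (λ e → ((S (Data.Product.proj₁ e)) ∧ (u == Data.Product.proj₂ e))
                               ∨ ((S (Data.Product.proj₂ e)) ∧ (u == Data.Product.proj₁ e))) A

  iter : ℕ → ((Fin n → Bool) → (Fin n → Bool)) → (Fin n → Bool) → (Fin n → Bool)
  iter zero f S = S
  iter (suc k) f S = f (iter k f S)

  -- the vertex set of the connected component of v in (Fin n, A)
  -- (n closure steps suffice, since a path has < n edges)
  component : Edges n → Fin n → (Fin n → Bool)
  component A v = iter n (grow A) (λ u → u == v)

  card : (Fin n → Bool) → ℕ
  card S = length (filter (λ u → S u Data.Bool.≟ true) (allFin n))

  isRep : Edges n → Fin n → Bool
  isRep A v = all (λ u → not (component A v u) ∨ (toℕ v ≤ᵇ toℕ u)) (allFin n)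

  componentSizes : Edges n → List ℕ
  componentSizes A = map (λ v → card (component A v)) (filter (λ v → isRep A v Data.Bool.≟ true) (allFin n))

  typeOf : Edges n → List ℕ
  typeOf A = type (componentSizes A)

  -- L(T): the edges not on the spine (not both endpoints internal)
  leafEdges : Edges n → Edges n
  leafEdges E = filter (λ e → not (isInternal E (Data.Product.proj₁ e) ∧ isInternal E (Data.Product.proj₂ e)) Data.Bool.≟ true) E

  -- U^L_T(x) = Σ_{L(T) ⊆ A ⊆ E} x_{λ(A)}
  UL : Edges n → List (List ℕ)
  UL E = map typeOf (filter (λ A → all (λ e → memB e A) (leafEdges E) Data.Bool.≟ true) (subsets E))

module Submission where

-- Every vertex u has a spine position sp(u): its own index if u is
-- internal, the index of its unique neighbour if u is a leaf; the fibre
-- sp⁻¹(i) has exactly β_i elements.  The edge list E is a permutation of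
-- L(T) ++ (e₀ ⋯ e_{k-2}) with e_i = v_i v_{i+1}, so the edge sets A ⊇ L(T)
-- are L(T) ++ (the e_i selected by a bit vector b of length k-1).  Reading
-- bit b_i = true as "merge across the gap i", the components of (V, A) are
-- exactly the fibres of u ↦ block_b(sp u), whose sizes form the coarsening
-- of β described by b.  Hence the two sides are the same list of types,
-- indexed by bit vectors.

open import Defs
open import Data.Nat using (ℕ; zero; suc; _+_; _≤_; _<_; z≤n; s≤s; _≤ᵇ_; _≡ᵇ_)
open import Data.Nat.Properties
  using (≤-refl; ≤-trans; ≤-antisym; ≤-reflexive; ≤-total; ≤-pred; n≤1+n; n<1+n; <-irrefl; <-trans;
         m≤n⇒m<n∨m≡n; m<m+n; +-suc; +-comm; +-identityʳ; +-mono-≤; +-monoʳ-≤; +-monoˡ-≤;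
         +-cancelˡ-≤; +-cancelʳ-≤; +-cancelˡ-≡; suc-injective; m+n≡0⇒m≡0; m+n≡0⇒n≡0;
         ≤ᵇ⇒≤; ≤⇒≤ᵇ; ≡ᵇ⇒≡; ≡⇒≡ᵇ; ≤-decTotalOrder; ≤-totalOrder; +-commutativeSemigroup)
open import Algebra.Properties.CommutativeSemigroup +-commutativeSemigroup using (interchange)
open import Data.Nat.ListAction using (sum)
open import Data.Bool using (Bool; true; false; _∧_; _∨_; not; if_then_else_; T)
import Data.Bool as Bool
open import Data.Bool.Properties using (not-involutive)
open import Data.Bool.ListAction using (any; all)
open import Data.Unit using (tt)
open import Data.Fin using (Fin; toℕ; fromℕ<) renaming (zero to fzero; suc to fsuc)
open import Data.Fin.Properties using (toℕ-injective; toℕ-fromℕ<)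
open import Data.List using (List; []; _∷_; [_]; map; _++_; filter; length; allFin; lookup; upTo; applyUpTo)
open import Data.List.Properties
  using (length-++; length-map; map-cong; map-cong-local; map-∘; map-++; ++-assoc; ++-identityʳ; filter-++;
         filter-≐; length-tabulate; ∷-injectiveˡ; ∷-injectiveʳ; length-applyUpTo; map-upTo)
open import Data.List.Membership.Propositional using (_∈_; _∉_)
open import Data.List.Relation.Binary.Subset.Propositional using (_⊆_)
open import Data.List.Membership.Propositional.Properties
  using (∈-∃++; ∈-++⁺ˡ; ∈-++⁺ʳ; ∈-++⁻; ∈-map⁺; ∈-map⁻; ∈-allFin; ∈-filter⁺; ∈-filter⁻;
         ∈-upTo⁺; ∈-upTo⁻; ∈-applyUpTo⁻)
open import Data.List.Relation.Unary.Any using (here; there)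
open import Data.List.Relation.Unary.All using (All; []; _∷_; tabulate)
open import Data.List.Relation.Unary.AllPairs using ([]; _∷_)
open import Data.List.Relation.Unary.Unique.Propositional using (Unique)
open import Data.List.Relation.Unary.Unique.Propositional.Properties
  using (allFin⁺; upTo⁺; applyUpTo⁺₁)
  renaming (filter⁺ to Unique-filter⁺)
open import Data.List.Relation.Binary.Permutation.Propositional
  using (_↭_; ↭-refl; ↭-prep; ↭-trans; ↭-sym; ↭⇒↭ₛ)
import Data.List.Relation.Binary.Permutation.Propositional as Perm
import Data.List.Relation.Binary.Permutation.Setoid.Properties as PermSetoid
open import Data.List.Relation.Binary.Permutation.Propositional.Properties
  using (shift; shifts; ++⁺; ++⁺ˡ; ++-comm; map⁺)
open import Data.List.Relation.Unary.Sorted.TotalOrder.Properties using (↗↭↗⇒≋)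
open import Data.List.Relation.Binary.Pointwise using (Pointwise-≡⇒≡)
import Data.List.Sort
open import Data.Product using (_×_; _,_; ∃; ∃₂; proj₁; proj₂)
open import Data.Sum using (_⊎_; inj₁; inj₂)
open import Data.Empty using (⊥; ⊥-elim)
open import Relation.Nullary using (¬_; yes; no)
open import Relation.Nullary.Decidable using (⌊_⌋)
open import Relation.Binary.PropositionalEquality
  using (_≡_; _≢_; refl; sym; trans; cong; cong₂; subst; subst₂; setoid; module ≡-Reasoning)
open import Function.Bundles using (_⇔_; Equivalence)

open Data.List.Sort ≤-decTotalOrder using (sort; sort-↭; sort-↗)

t≢f : true ≢ false
t≢f ()

∨-elim : ∀ a b → (a ∨ b) ≡ true → a ≡ true ⊎ b ≡ true
∨-elim true b e = inj₁ refl
∨-elim false b e = inj₂ e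

∨-introˡ : ∀ a b → a ≡ true → (a ∨ b) ≡ true
∨-introˡ true b e = refl

∨-introʳ : ∀ a b → b ≡ true → (a ∨ b) ≡ true
∨-introʳ true b e = refl
∨-introʳ false b e = e

∧-elim : ∀ a b → (a ∧ b) ≡ true → a ≡ true × b ≡ true
∧-elim true true e = refl , refl

∧-intro : ∀ {a b} → a ≡ true → b ≡ true → (a ∧ b) ≡ true
∧-intro refl refl = refl

not-true : ∀ {b} → ¬ (b ≡ true) → b ≡ false
not-true {true} h = ⊥-elim (h refl)
not-true {false} h = refl

bool-ext : ∀ a b → (a ≡ true → b ≡ true) → (b ≡ true → a ≡ true) → a ≡ b
bool-ext true true f g = refl
bool-ext true false f g = sym (f refl)
bool-ext false true f g = g refl
bool-ext false false f g = refl

≡ᵇ-elim : ∀ {a b} → (a ≡ᵇ b) ≡ true → a ≡ b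
≡ᵇ-elim {a} {b} e = ≡ᵇ⇒≡ a b (subst T (sym e) tt)

≡ᵇ-intro : ∀ {a b} → a ≡ b → (a ≡ᵇ b) ≡ true
≡ᵇ-intro {a} {b} e with a ≡ᵇ b | ≡⇒≡ᵇ a b e
... | true | _ = refl

≤ᵇ-elim : ∀ {a b} → (a ≤ᵇ b) ≡ true → a ≤ b
≤ᵇ-elim {a} {b} e = ≤ᵇ⇒≤ a b (subst T (sym e) tt)

≤ᵇ-intro : ∀ {a b} → a ≤ b → (a ≤ᵇ b) ≡ true
≤ᵇ-intro {a} {b} p with a ≤ᵇ b | ≤⇒≤ᵇ p
... | true | _ = refl

≟-elim : ∀ a b → ⌊ a Data.Nat.≟ b ⌋ ≡ true → a ≡ b
≟-elim a b h with a Data.Nat.≟ b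
... | yes p = p
... | no _ = ⊥-elim (t≢f (sym h))

≟-intro : ∀ {a b} → a ≡ b → ⌊ a Data.Nat.≟ b ⌋ ≡ true
≟-intro {a} {b} e with a Data.Nat.≟ b
... | yes _ = refl
... | no a≢b = ⊥-elim (a≢b e)

ind : Bool → ℕ → ℕ
ind b a = if b then a else 0

module _ {A : Set} where

  filt : (A → Bool) → List A → List A
  filt p = filter (λ x → p x Bool.≟ true)

  filt-cong : (p q : A → Bool) → (∀ x → p x ≡ q x) → ∀ xs → filt p xs ≡ filt q xs
  filt-cong p q h = filter-≐ _ _ ((λ e → trans (sym (h _)) e) , (λ e → trans (h _) e))

  filt⁺ : (p : A → Bool) {x : A} (xs : List A) → x ∈ xs → p x ≡ true → x ∈ filt p xs
  filt⁺ p xs = ∈-filter⁺ (λ x → p x Bool.≟ true)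

  filt⁻ : (p : A → Bool) {x : A} (xs : List A) → x ∈ filt p xs → x ∈ xs × p x ≡ true
  filt⁻ p xs = ∈-filter⁻ (λ x → p x Bool.≟ true)

  filt-length : (p : A → Bool) (xs : List A) →
                length xs ≡ length (filt p xs) + length (filt (λ x → not (p x)) xs)
  filt-length p [] = refl
  filt-length p (x ∷ xs) with p x
  ... | true = cong suc (filt-length p xs)
  ... | false = trans (cong suc (filt-length p xs)) (sym (+-suc _ _))

  filt-partition : (p : A → Bool) (xs : List A) → xs ↭ filt (λ x → not (p x)) xs ++ filt p xs
  filt-partition p [] = ↭-refl
  filt-partition p (x ∷ xs) with p x
  ... | false = ↭-prep x (filt-partition p xs)
  ... | true = ↭-trans (↭-prep x (filt-partition p xs)) (↭-sym (shift x _ _))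

  filt-filt : (p q : A → Bool) (xs : List A) → (∀ x → p x ≡ true → q x ≡ true) →
              filt p xs ≡ filt p (filt q xs)
  filt-filt p q [] h = refl
  filt-filt p q (x ∷ xs) h with q x in eq
  ... | true with p x
  ...   | true = cong (x ∷_) (filt-filt p q xs h)
  ...   | false = filt-filt p q xs h
  filt-filt p q (x ∷ xs) h | false with p x in ep
  ...   | false = filt-filt p q xs h
  ...   | true = ⊥-elim (t≢f (trans (sym (h x ep)) eq))

  count : (A → Bool) → List A → ℕ
  count p xs = length (filt p xs)

  count-pos : (p : A → Bool) {x : A} (xs : List A) → x ∈ xs → p x ≡ true → 1 ≤ count p xs
  count-pos p xs m px with filt p xs | filt⁺ p xs m px
  ... | _ ∷ _ | _ = s≤s z≤n

  count-∷ : (p : A → Bool) (x : A) (xs : List A) → count p (x ∷ xs) ≡ ind (p x) 1 + count p xs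
  count-∷ p x xs with p x
  ... | true = refl
  ... | false = refl

  count-split : (p q : A → Bool) (xs : List A) →
                count p xs ≡ count (λ x → p x ∧ q x) xs + count (λ x → p x ∧ not (q x)) xs
  count-split p q [] = refl
  count-split p q (x ∷ xs) with p x
  ... | false = count-split p q xs
  ... | true with q x
  ...   | true = cong suc (count-split p q xs)
  ...   | false = trans (cong suc (count-split p q xs)) (sym (+-suc _ _))

  any⁻ : (p : A → Bool) (xs : List A) → any p xs ≡ true → ∃ λ x → x ∈ xs × p x ≡ true
  any⁻ p (x ∷ xs) e with ∨-elim (p x) (any p xs) e
  ... | inj₁ h = x , here refl , h
  ... | inj₂ h = let (y , m , q) = any⁻ p xs h in y , there m , q

  any⁺ : (p : A → Bool) (xs : List A) {x : A} → x ∈ xs → p x ≡ true → any p xs ≡ true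
  any⁺ p (y ∷ xs) (here refl) h = ∨-introˡ (p y) _ h
  any⁺ p (y ∷ xs) (there m) h = ∨-introʳ (p y) _ (any⁺ p xs m h)

  all⁻ : (p : A → Bool) (xs : List A) → all p xs ≡ true → ∀ {x} → x ∈ xs → p x ≡ true
  all⁻ p (y ∷ xs) e (here refl) = proj₁ (∧-elim (p y) _ e)
  all⁻ p (y ∷ xs) e (there m) = all⁻ p xs (proj₂ (∧-elim (p y) _ e)) m

  all⁺ : (p : A → Bool) (xs : List A) → (∀ {x} → x ∈ xs → p x ≡ true) → all p xs ≡ true
  all⁺ p [] h = refl
  all⁺ p (y ∷ xs) h = ∧-intro (h (here refl)) (all⁺ p xs (λ m → h (there m)))

-- the first component of Unique (x ∷ ys) states x ∉ ys
∉-All : ∀ {X : Set} {x : X} ys → x ∉ ys → All (λ y → ¬ x ≡ y) ys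
∉-All [] _ = []
∉-All (y ∷ ys) nm = (λ e → nm (here e)) ∷ ∉-All ys (λ m → nm (there m))

All-∉ : ∀ {X : Set} {x : X} {ys} → All (λ y → ¬ x ≡ y) ys → x ∉ ys
All-∉ (h ∷ _) (here e) = h e
All-∉ (_ ∷ hs) (there m) = All-∉ hs m

module _ {A : Set} where

  _≈_ : List A → List A → Set
  xs ≈ ys = (xs ⊆ ys) × (ys ⊆ xs)

  private
    ⊆-remove : ∀ {y : A} ys as bs → y ∉ ys → ys ⊆ (as ++ [ y ] ++ bs) → ys ⊆ (as ++ bs)
    ⊆-remove ys as bs y∉ sub m with ∈-++⁻ as (sub m)
    ... | inj₁ p = ∈-++⁺ˡ p
    ... | inj₂ (here refl) = ⊥-elim (y∉ m)
    ... | inj₂ (there p) = ∈-++⁺ʳ as p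

    length-remove : (as bs : List A) (y : A) → length (as ++ [ y ] ++ bs) ≡ suc (length (as ++ bs))
    length-remove as bs y = trans (length-++ as) (trans (+-suc (length as) (length bs)) (cong suc (sym (length-++ as))))

  unique-⊆-length : (ys xs : List A) → Unique ys → ys ⊆ xs → length ys ≤ length xs
  unique-⊆-length [] xs u s = z≤n
  unique-⊆-length (y ∷ ys) xs (y∉ ∷ u) s with ∈-∃++ (s (here refl))
  ... | as , bs , refl =
    subst (suc (length ys) ≤_) (sym (length-remove as bs y))
      (s≤s (unique-⊆-length ys (as ++ bs) u (⊆-remove ys as bs (All-∉ y∉) (λ m → s (there m)))))

  unique-≈-length : (xs ys : List A) → Unique xs → Unique ys → xs ≈ ys → length xs ≡ length ys
  unique-≈-length xs ys ux uy (s₁ , s₂) = ≤-antisym (unique-⊆-length xs ys ux s₁) (unique-⊆-length ys xs uy s₂)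

  unique-⊆-↭ : (ys xs : List A) → Unique ys → ys ⊆ xs → length xs ≤ length ys → xs ↭ ys
  unique-⊆-↭ [] [] u s l = ↭-refl
  unique-⊆-↭ [] (x ∷ xs) u s ()
  unique-⊆-↭ (y ∷ ys) xs (y∉ ∷ u) s l with ∈-∃++ (s (here refl))
  ... | as , bs , refl = ↭-trans (shift y as bs) (↭-prep y
      (unique-⊆-↭ ys (as ++ bs) u (⊆-remove ys as bs (All-∉ y∉) (λ m → s (there m)))
        (≤-pred (subst (_≤ suc (length ys)) (length-remove as bs y) l))))

  unique-map : {B : Set} (f : A → B) (xs : List A) → Unique xs →
               (∀ {x y} → x ∈ xs → y ∈ xs → f x ≡ f y → x ≡ y) → Unique (map f xs)
  unique-map f [] u inj = []
  unique-map f (x ∷ xs) (x∉ ∷ u) inj =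
    ∉-All _ fx∉ ∷ unique-map f xs u (λ mx my → inj (there mx) (there my))
    where
    fx∉ : f x ∉ map f xs
    fx∉ m with ∈-map⁻ f m
    ... | y , my , e = All-∉ x∉ (subst (_∈ xs) (sym (inj (here refl) (there my) e)) my)

2≰1 : ¬ (2 ≤ 1)
2≰1 (s≤s ())

squeeze : ∀ {a b c d} → a ≤ b → c ≤ d → a + c ≡ b + d → b ≤ a × d ≤ c
squeeze {a} {b} {c} {d} a≤b c≤d e =
  +-cancelʳ-≤ c b a (≤-trans (+-monoʳ-≤ b c≤d) (≤-reflexive (sym e))) ,
  +-cancelˡ-≤ a d c (≤-trans (+-monoˡ-≤ d a≤b) (≤-reflexive (sym e)))

sort-↭-≡ : (xs ys : List ℕ) → xs ↭ ys → sort xs ≡ sort ys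
sort-↭-≡ xs ys p = Pointwise-≡⇒≡ (↗↭↗⇒≋ ≤-totalOrder (sort-↗ xs) (sort-↗ ys)
  (↭⇒↭ₛ (↭-trans (sort-↭ xs) (↭-trans p (↭-sym (sort-↭ ys))))))

module _ {n : ℕ} where

  ==-elim : {u v : Fin n} → (u == v) ≡ true → u ≡ v
  ==-elim {u} {v} e with u Data.Fin.≟ v
  ... | yes p = p
  ... | no _ = ⊥-elim (t≢f (sym e))

  ==-refl : (u : Fin n) → (u == u) ≡ true
  ==-refl u with u Data.Fin.≟ u
  ... | yes _ = refl
  ... | no u≢u = ⊥-elim (u≢u refl)

  ==-intro : {u v : Fin n} → u ≡ v → (u == v) ≡ true
  ==-intro {u} refl = ==-refl u

  ==-false : {u v : Fin n} → u ≢ v → (u == v) ≡ false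
  ==-false {u} {v} u≢v with u Data.Fin.≟ v
  ... | yes p = ⊥-elim (u≢v p)
  ... | no _ = refl

  adj-sym : ∀ {A : Edges n} {u v} → Adj A u v → Adj A v u
  adj-sym (inj₁ m) = inj₂ m
  adj-sym (inj₂ m) = inj₁ m

  -- walks of a given length, built from the right as the growth steps are
  data Walk (A : Edges n) : ℕ → Fin n → Fin n → Set where
    nil : ∀ {v} → Walk A 0 v v
    snoc : ∀ {d v w u} → Walk A d v w → Adj A w u → Walk A (suc d) v u

  walk-cons : ∀ {A d v w u} → Adj A v w → Walk A d w u → Walk A (suc d) v u
  walk-cons a nil = snoc nil a
  walk-cons a (snoc p b) = snoc (walk-cons a p) b

  walk-reverse : ∀ {A d v u} → Walk A d v u → Walk A d u v
  walk-reverse nil = nil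
  walk-reverse (snoc p a) = walk-cons (adj-sym a) (walk-reverse p)

  walk-++ : ∀ {A d d' v w u} → Walk A d v w → Walk A d' w u → Walk A (d + d') v u
  walk-++ nil q = q
  walk-++ {A} {suc d} {d'} {v} {u = u} (snoc p a) q =
    subst (λ t → Walk A t v u) (+-suc d d') (walk-++ p (walk-cons a q))

  grow-keeps : (A : Edges n) (S : Fin n → Bool) (u : Fin n) → S u ≡ true → grow A S u ≡ true
  grow-keeps A S u e = ∨-introˡ (S u) _ e

  grow-step : (A : Edges n) (S : Fin n → Bool) {w u : Fin n} → S w ≡ true → Adj A w u → grow A S u ≡ true
  grow-step A S {w} {u} sw (inj₁ m) =
    ∨-introʳ (S u) _ (any⁺ _ A m (∨-introˡ _ _ (∧-intro sw (==-refl u))))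
  grow-step A S {w} {u} sw (inj₂ m) =
    ∨-introʳ (S u) _ (any⁺ _ A m (∨-introʳ (S u ∧ (u == w)) _ (∧-intro sw (==-refl u))))

  iter-mono : (A : Edges n) (S : Fin n → Bool) (u : Fin n) {d d' : ℕ} → d ≤ d' →
              iter d (grow A) S u ≡ true → iter d' (grow A) S u ≡ true
  iter-mono A S u {d' = zero} z≤n e = e
  iter-mono A S u {d} {suc d'} le e with m≤n⇒m<n∨m≡n le
  ... | inj₂ refl = e
  ... | inj₁ (s≤s le') = grow-keeps A (iter d' (grow A) S) u (iter-mono A S u le' e)

  walk-iter : (A : Edges n) (S : Fin n → Bool) {d : ℕ} {v u : Fin n} →
              S v ≡ true → Walk A d v u → iter d (grow A) S u ≡ true
  walk-iter A S sv nil = sv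
  walk-iter A S sv (snoc {d = d} p a) = grow-step A (iter d (grow A) S) (walk-iter A S sv p) a

  iter-sound : (A : Edges n) (f : Fin n → ℕ) (c : ℕ) → (∀ {e} → e ∈ A → f (proj₁ e) ≡ f (proj₂ e)) →
               (S : Fin n → Bool) → (∀ u → S u ≡ true → f u ≡ c) →
               ∀ d u → iter d (grow A) S u ≡ true → f u ≡ c
  iter-sound A f c f-edge S hS zero u e = hS u e
  iter-sound A f c f-edge S hS (suc d) u e with ∨-elim _ _ e
  ... | inj₁ e' = iter-sound A f c f-edge S hS d u e'
  ... | inj₂ e' with any⁻ _ A e'
  ...   | (a , b) , m , q with ∨-elim _ _ q
  ...     | inj₁ q' = let (x , y) = ∧-elim _ _ q' in
            trans (cong f (==-elim y)) (trans (sym (f-edge m)) (iter-sound A f c f-edge S hS d a x))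
  ...     | inj₂ q' = let (x , y) = ∧-elim _ _ q' in
            trans (cong f (==-elim y)) (trans (f-edge m) (iter-sound A f c f-edge S hS d b x))

  least : ∀ {m} (P : Fin m → Bool) (u : Fin m) → P u ≡ true →
          ∃ λ w → P w ≡ true × (∀ x → P x ≡ true → toℕ w ≤ toℕ x)
  least {suc m} P u pu with P fzero in e
  ... | true = fzero , e , (λ x _ → z≤n)
  least {suc m} P fzero pu | false = ⊥-elim (t≢f (trans (sym pu) e))
  least {suc m} P (fsuc u) pu | false with least (λ x → P (fsuc x)) u pu
  ... | w , pw , w-least = fsuc w , pw , bound
    where
    bound : ∀ x → P x ≡ true → toℕ (fsuc w) ≤ toℕ x
    bound fzero px = ⊥-elim (t≢f (trans (sym px) e))
    bound (fsuc x) px = s≤s (w-least x px)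

  -- If a labelling f of the vertices by
  -- 0 ⋯ m-1 is onto, constant along the edges of A, and any two vertices
  -- with the same label are joined by a walk of length ≤ n, then the
  -- components of (Fin n, A) are the fibres of f; so the component sizes
  -- are the fibre sizes, listed by label.
  module Labelling (A : Edges n) (f : Fin n → ℕ) (m : ℕ)
    (label-bound : ∀ u → f u < m)
    (label-onto : ∀ j → j < m → ∃ λ u → f u ≡ j)
    (label-edge : ∀ {e} → e ∈ A → f (proj₁ e) ≡ f (proj₂ e))
    (label-walk : ∀ u v → f u ≡ f v → ∃ λ d → d ≤ n × Walk A d v u) where

    component-fibre : ∀ v u → component A v u ≡ (f u ≡ᵇ f v)
    component-fibre v u = bool-ext _ _
      (λ e → ≡ᵇ-intro (iter-sound A f (f v) label-edge (λ u → u == v) (λ u q → cong f (==-elim q)) n u e))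
      (λ e → let (d , d≤n , w) = label-walk u v (≡ᵇ-elim e) in
             iter-mono A (λ u → u == v) u d≤n (walk-iter A (λ u → u == v) (==-refl v) w))

    fibreSize : ℕ → ℕ
    fibreSize j = count (λ u → f u ≡ᵇ j) (allFin n)

    card-component : ∀ v → card (component A v) ≡ fibreSize (f v)
    card-component v = cong length (filt-cong _ _ (component-fibre v) (allFin n))

    reps : List (Fin n)
    reps = filt (isRep A) (allFin n)

    rep-least : ∀ {v} → v ∈ reps → ∀ u → f u ≡ f v → toℕ v ≤ toℕ u
    rep-least {v} mv u e with all⁻ _ (allFin n) (proj₂ (filt⁻ (isRep A) (allFin n) mv)) (∈-allFin u)
    ... | q with component A v u in ce
    ... | true = ≤ᵇ-elim q
    ... | false = ⊥-elim (t≢f (trans (sym (≡ᵇ-intro e)) (trans (sym (component-fibre v u)) ce)))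

    least-rep : ∀ v → (∀ u → f u ≡ f v → toℕ v ≤ toℕ u) → v ∈ reps
    least-rep v h = filt⁺ (isRep A) (allFin n) (∈-allFin v) (all⁺ _ (allFin n) λ {u} _ → minimal u)
      where
      minimal : ∀ u → (not (component A v u) ∨ (toℕ v ≤ᵇ toℕ u)) ≡ true
      minimal u with component A v u in ce
      ... | false = refl
      ... | true = ≤ᵇ-intro (h u (≡ᵇ-elim (trans (sym (component-fibre v u)) ce)))

    labels-unique : Unique (map f reps)
    labels-unique = unique-map f reps (Unique-filter⁺ _ (allFin⁺ n))
      (λ mx my e → toℕ-injective (≤-antisym (rep-least mx _ (sym e)) (rep-least my _ e)))

    labels-⊆ : map f reps ⊆ upTo m
    labels-⊆ q with ∈-map⁻ f q
    ... | v , _ , refl = ∈-upTo⁺ (label-bound v)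

    upTo-⊆ : upTo m ⊆ map f reps
    upTo-⊆ {j} q with label-onto j (∈-upTo⁻ q)
    ... | u , fu with least (λ x → f x ≡ᵇ j) u (≡ᵇ-intro fu)
    ... | w , pw , w-least = subst (_∈ map f reps) (≡ᵇ-elim pw)
          (∈-map⁺ f (least-rep w (λ x e → w-least x (≡ᵇ-intro (trans e (≡ᵇ-elim pw))))))

    labels-↭ : map f reps ↭ upTo m
    labels-↭ = unique-⊆-↭ (upTo m) (map f reps) (upTo⁺ m) upTo-⊆
      (unique-⊆-length _ _ labels-unique labels-⊆)

    componentSizes-↭ : componentSizes A ↭ applyUpTo fibreSize m
    componentSizes-↭ = subst₂ _↭_ (sym sizes≡) (map-upTo fibreSize m) (map⁺ fibreSize labels-↭)
      where
      sizes≡ : componentSizes A ≡ map fibreSize (map f reps)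
      sizes≡ = trans (map-cong card-component reps) (map-∘ reps)

module _ {A : Set} where

  any-≈ : (p : A → Bool) {xs ys : List A} → xs ≈ ys → any p xs ≡ any p ys
  any-≈ p {xs} {ys} (s₁ , s₂) = bool-ext _ _
    (λ e → let (x , m , q) = any⁻ p xs e in any⁺ p ys (s₁ m) q)
    (λ e → let (x , m , q) = any⁻ p ys e in any⁺ p xs (s₂ m) q)

  any-cong : (p q : A → Bool) → (∀ x → p x ≡ q x) → ∀ xs → any p xs ≡ any q xs
  any-cong p q h xs = cong Data.Bool.ListAction.or (map-cong h xs)

  all-cong : (p q : A → Bool) → (∀ x → p x ≡ q x) → ∀ xs → all p xs ≡ all q xs
  all-cong p q h xs = cong Data.Bool.ListAction.and (map-cong h xs)

  ≈-∷ : ∀ x {xs ys : List A} → xs ≈ ys → (x ∷ xs) ≈ (x ∷ ys)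
  ≈-∷ x (s₁ , s₂) = (λ { (here e) → here e ; (there m) → there (s₁ m) })
                  , (λ { (here e) → here e ; (there m) → there (s₂ m) })

  ≈-swap : ∀ (x y : A) xs → (x ∷ y ∷ xs) ≈ (y ∷ x ∷ xs)
  ≈-swap x y xs = swap , swap
    where
    swap : ∀ {a b} → (a ∷ b ∷ xs) ⊆ (b ∷ a ∷ xs)
    swap (here e) = there (here e)
    swap (there (here e)) = here e
    swap (there (there m)) = there (there m)

module _ {n : ℕ} where

  SetInvariant : {X : Set} → (Edges n → X) → Set
  SetInvariant g = ∀ {A A'} → A ≈ A' → g A ≡ g A'

  component-≈ : ∀ {A A' : Edges n} → A ≈ A' → ∀ v u → component A v u ≡ component A' v u
  component-≈ {A} {A'} A≈A' v u = iter-≈ n _ u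
    where
    grow-≈ : (X Y : Fin n → Bool) → (∀ w → X w ≡ Y w) → ∀ u → grow A X u ≡ grow A' Y u
    grow-≈ X Y h u = cong₂ _∨_ (h u) (trans (any-≈ _ A≈A')
      (any-cong _ _ (λ e → cong₂ _∨_ (cong (_∧ _) (h (proj₁ e))) (cong (_∧ _) (h (proj₂ e)))) A'))
    iter-≈ : ∀ d S u → iter d (grow A) S u ≡ iter d (grow A') S u
    iter-≈ zero S u = refl
    iter-≈ (suc d) S u = grow-≈ _ _ (iter-≈ d S) u

  typeOf-≈ : SetInvariant (typeOf {n})
  typeOf-≈ {A} {A'} A≈A' = cong type (trans
      (cong (map (λ v → card (component A v))) (filt-cong _ _ isRep-≈ (allFin n)))
      (map-cong (λ v → cong length (filt-cong _ _ (component-≈ A≈A' v) (allFin n))) _))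
    where
    isRep-≈ : ∀ v → isRep A v ≡ isRep A' v
    isRep-≈ v = all-cong _ _ (λ u → cong (λ b → not b ∨ _) (component-≈ A≈A' v u)) (allFin n)

  edgeEq-elim : (e x : Fin n × Fin n) → edgeEq e x ≡ true → e ≡ x
  edgeEq-elim (a , b) (c , d) h = let (p , q) = ∧-elim _ _ h in cong₂ _,_ (==-elim p) (==-elim q)

  memB⁻ : (e : Fin n × Fin n) (A : Edges n) → memB e A ≡ true → e ∈ A
  memB⁻ e A h with any⁻ (edgeEq e) A h
  ... | x , m , q = subst (_∈ A) (sym (edgeEq-elim e x q)) m

  memB⁺ : (e : Fin n × Fin n) (A : Edges n) → e ∈ A → memB e A ≡ true
  memB⁺ (a , b) A m = any⁺ (edgeEq (a , b)) A m (∧-intro (==-refl a) (==-refl b))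


module _ {n : ℕ} where

  subsets-⊆ : (xs : Edges n) {A : Edges n} → A ∈ subsets xs → A ⊆ xs
  subsets-⊆ [] (here refl) ()
  subsets-⊆ (x ∷ xs) m with ∈-++⁻ (map (x ∷_) (subsets xs)) m
  ... | inj₂ m' = λ q → there (subsets-⊆ xs m' q)
  ... | inj₁ m' with ∈-map⁻ (x ∷_) m'
  ... | B , mB , refl = λ { (here e) → here e ; (there q) → there (subsets-⊆ xs mB q) }

  over : {X : Set} → (Edges n → X) → (Edges n → Bool) → Edges n → List X
  over g Q xs = map g (filt Q (subsets xs))

  with-edge : ∀ {X : Set} → Fin n × Fin n → (Edges n → X) → Edges n → X
  with-edge x g A = g (x ∷ A)

  with-edge-inv : ∀ {X : Set} x {g : Edges n → X} → SetInvariant g → SetInvariant (with-edge x g)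
  with-edge-inv x ig s = ig (≈-∷ x s)

  over-∷ : ∀ {X : Set} (g : Edges n → X) (Q : Edges n → Bool) x xs →
           over g Q (x ∷ xs) ≡ over (with-edge x g) (with-edge x Q) xs ++ over g Q xs
  over-∷ g Q x xs = begin
    map g (filt Q (map (x ∷_) S ++ S))
      ≡⟨ cong (map g) (filter-++ _ (map (x ∷_) S) S) ⟩
    map g (filt Q (map (x ∷_) S) ++ filt Q S)
      ≡⟨ cong (λ l → map g (l ++ filt Q S)) (filt-map-∷ S) ⟩
    map g (map (x ∷_) (filt (with-edge x Q) S) ++ filt Q S)
      ≡⟨ map-++ g _ (filt Q S) ⟩
    map g (map (x ∷_) (filt (with-edge x Q) S)) ++ over g Q xs
      ≡⟨ cong (_++ over g Q xs) (sym (map-∘ (filt (with-edge x Q) S))) ⟩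
    over (with-edge x g) (with-edge x Q) xs ++ over g Q xs ∎
    where
    open ≡-Reasoning
    S = subsets xs
    filt-map-∷ : ∀ T → filt Q (map (x ∷_) T) ≡ map (x ∷_) (filt (with-edge x Q) T)
    filt-map-∷ [] = refl
    filt-map-∷ (A ∷ T) with Q (x ∷ A)
    ... | true = cong ((x ∷ A) ∷_) (filt-map-∷ T)
    ... | false = filt-map-∷ T

  over-cong : ∀ {X : Set} (g g' : Edges n → X) (Q Q' : Edges n → Bool) xs →
              (∀ A → g A ≡ g' A) → (∀ A → Q A ≡ Q' A) → over g Q xs ≡ over g' Q' xs
  over-cong g g' Q Q' xs hg hQ = trans (cong (map g) (filt-cong Q Q' hQ (subsets xs))) (map-cong hg _)

  over-↭ : ∀ {X : Set} (g : Edges n → X) (Q : Edges n → Bool) → SetInvariant g → SetInvariant Q →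
           ∀ {xs ys} → xs ↭ ys → over g Q xs ↭ over g Q ys
  over-↭ g Q ig iQ Perm.refl = ↭-refl
  over-↭ g Q ig iQ {x ∷ xs} {x ∷ ys} (Perm.prep x p) =
    subst₂ _↭_ (sym (over-∷ g Q x xs)) (sym (over-∷ g Q x ys))
      (++⁺ (over-↭ _ _ (with-edge-inv x ig) (with-edge-inv x iQ) p) (over-↭ g Q ig iQ p))
  over-↭ g Q ig iQ {x ∷ y ∷ xs} {y ∷ x ∷ ys} (Perm.swap x y p) = begin
    over g Q (x ∷ y ∷ xs)
      ≡⟨ expand x y xs ⟩
    over (W y (W x g)) (W y (W x Q)) xs ++ over (W x g) (W x Q) xs ++ over (W y g) (W y Q) xs ++ over g Q xs
      ↭⟨ ++⁺ (over-↭ _ _ (inv y (inv x ig)) (inv y (inv x iQ)) p) (++⁺ (over-↭ _ _ (inv x ig) (inv x iQ) p)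
           (++⁺ (over-↭ _ _ (inv y ig) (inv y iQ) p) (over-↭ g Q ig iQ p))) ⟩
    over (W y (W x g)) (W y (W x Q)) ys ++ over (W x g) (W x Q) ys ++ over (W y g) (W y Q) ys ++ over g Q ys
      ≡⟨ cong (_++ (over (W x g) (W x Q) ys ++ over (W y g) (W y Q) ys ++ over g Q ys))
              (over-cong _ _ _ _ ys (λ A → ig (≈-swap x y A)) (λ A → iQ (≈-swap x y A))) ⟩
    over (W x (W y g)) (W x (W y Q)) ys ++ over (W x g) (W x Q) ys ++ over (W y g) (W y Q) ys ++ over g Q ys
      ↭⟨ ++⁺ˡ (over (W x (W y g)) (W x (W y Q)) ys) (shifts (over (W x g) (W x Q) ys) (over (W y g) (W y Q) ys)) ⟩
    over (W x (W y g)) (W x (W y Q)) ys ++ over (W y g) (W y Q) ys ++ over (W x g) (W x Q) ys ++ over g Q ys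
      ≡⟨ expand y x ys ⟨
    over g Q (y ∷ x ∷ ys) ∎
    where
    open Perm.PermutationReasoning
    W = with-edge
    inv = with-edge-inv
    expand : ∀ a b zs → over g Q (a ∷ b ∷ zs) ≡ over (W b (W a g)) (W b (W a Q)) zs ++
             over (W a g) (W a Q) zs ++ over (W b g) (W b Q) zs ++ over g Q zs
    expand a b zs = trans (over-∷ g Q a (b ∷ zs))
      (trans (cong₂ _++_ (over-∷ (W a g) (W a Q) b zs) (over-∷ g Q b zs))
        (++-assoc (over (W b (W a g)) (W b (W a Q)) zs) _ _))
  over-↭ g Q ig iQ (Perm.trans p q) = ↭-trans (over-↭ g Q ig iQ p) (over-↭ g Q ig iQ q)

  contains : Edges n → Edges n → Bool
  contains L A = all (λ e → memB e A) L

  contains-∷ : ∀ L e A → e ∉ L → contains L (e ∷ A) ≡ contains L A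
  contains-∷ [] e A e∉ = refl
  contains-∷ (e' ∷ L) e A e∉ =
    cong₂ _∧_ (cong (_∨ memB e' A) (not-true (λ h → e∉ (here (sym (edgeEq-elim e' e h))))))
              (contains-∷ L e A (λ m → e∉ (there m)))

  contains-≈ : (L : Edges n) → SetInvariant (contains L)
  contains-≈ L A≈A' = all-cong _ _ (λ e → any-≈ (edgeEq e) A≈A') L

  over-prefix : ∀ {X : Set} (L S : Edges n) → Unique L → (∀ {e} → e ∈ L → e ∉ S) → (g : Edges n → X) →
                over g (contains L) (L ++ S) ≡ map (λ T → g (L ++ T)) (subsets S)
  over-prefix [] S u disj g = cong (map g) (filt-all (subsets S))
    where
    filt-all : ∀ T → filt (contains []) T ≡ T
    filt-all [] = refl
    filt-all (A ∷ T) = cong (A ∷_) (filt-all T)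
  over-prefix (e ∷ L) S (e∉L ∷ u) disj g = begin
    over g (contains (e ∷ L)) (e ∷ (L ++ S))
      ≡⟨ over-∷ g (contains (e ∷ L)) e (L ++ S) ⟩
    over (with-edge e g) (with-edge e (contains (e ∷ L))) (L ++ S) ++ over g (contains (e ∷ L)) (L ++ S)
      ≡⟨ cong₂ _++_ (over-cong _ _ _ _ (L ++ S) (λ _ → refl) with-e) (cong (map g) (filt-none (subsets (L ++ S)) (λ m → m))) ⟩
    over (with-edge e g) (contains L) (L ++ S) ++ []
      ≡⟨ ++-identityʳ _ ⟩
    over (with-edge e g) (contains L) (L ++ S)
      ≡⟨ over-prefix L S u (λ m → disj (there m)) (with-edge e g) ⟩
    map (λ T → g (e ∷ (L ++ T))) (subsets S) ∎
    where
    open ≡-Reasoning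
    e∉LS : e ∉ L ++ S
    e∉LS m with ∈-++⁻ L m
    ... | inj₁ m' = All-∉ e∉L m'
    ... | inj₂ m' = disj (here refl) m'
    with-e : ∀ A → contains (e ∷ L) (e ∷ A) ≡ contains L A
    with-e A = trans (cong (_∧ contains L (e ∷ A)) (memB⁺ e (e ∷ A) (here refl))) (contains-∷ L e A (All-∉ e∉L))
    filt-none : ∀ T → T ⊆ subsets (L ++ S) → filt (contains (e ∷ L)) T ≡ []
    filt-none [] _ = refl
    filt-none (A ∷ T) sub with memB e A in eA
    ... | true = ⊥-elim (e∉LS (subsets-⊆ (L ++ S) (sub (here refl)) (memB⁻ e A eA)))
    ... | false = filt-none T (λ m → sub (there m))

-- all bit vectors of length k, in the order matching `subsets`
allBits : ℕ → List (List Bool)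
allBits zero = [ [] ]
allBits (suc k) = map (true ∷_) (allBits k) ++ map (false ∷_) (allBits k)

allBits-length : ∀ k {bs} → bs ∈ allBits k → length bs ≡ k
allBits-length zero (here refl) = refl
allBits-length (suc k) m with ∈-++⁻ (map (true ∷_) (allBits k)) m
... | inj₁ m' with ∈-map⁻ (true ∷_) m'
...   | b , mb , refl = cong suc (allBits-length k mb)
allBits-length (suc k) m | inj₂ m' with ∈-map⁻ (false ∷_) m'
...   | b , mb , refl = cong suc (allBits-length k mb)

select : ∀ {A : Set} → List Bool → List A → List A
select (true ∷ bs) (x ∷ xs) = x ∷ select bs xs
select (false ∷ bs) (x ∷ xs) = select bs xs
select _ _ = []

subsets-select : ∀ {n} (xs : Edges n) → subsets xs ≡ map (λ bs → select bs xs) (allBits (length xs))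
subsets-select [] = refl
subsets-select (e ∷ es) = begin
  map (e ∷_) (subsets es) ++ subsets es
    ≡⟨ cong₂ (λ a b → map (e ∷_) a ++ b) (subsets-select es) (subsets-select es) ⟩
  map (e ∷_) (map (λ bs → select bs es) B) ++ map (λ bs → select bs es) B
    ≡⟨ cong₂ _++_ (trans (sym (map-∘ B)) (map-∘ B)) (map-∘ B) ⟩
  map (λ bs → select bs (e ∷ es)) (map (true ∷_) B) ++ map (λ bs → select bs (e ∷ es)) (map (false ∷_) B)
    ≡⟨ map-++ _ (map (true ∷_) B) _ ⟨
  map (λ bs → select bs (e ∷ es)) (map (true ∷_) B ++ map (false ∷_) B) ∎
  where
  open ≡-Reasoning
  B = allBits (length es)

bit : List Bool → ℕ → Bool
bit [] _ = false
bit (b ∷ bs) zero = b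
bit (b ∷ bs) (suc i) = bit bs i

select-applyUpTo⁻ : ∀ {A : Set} (f : ℕ → A) bs c {e} → e ∈ select bs (applyUpTo f c) →
                    ∃ λ t → t < c × bit bs t ≡ true × e ≡ f t
select-applyUpTo⁻ f (true ∷ bs) (suc c) (here refl) = 0 , s≤s z≤n , refl , refl
select-applyUpTo⁻ f (true ∷ bs) (suc c) (there m) with select-applyUpTo⁻ (λ i → f (suc i)) bs c m
... | t , t<c , b , e = suc t , s≤s t<c , b , e
select-applyUpTo⁻ f (false ∷ bs) (suc c) m with select-applyUpTo⁻ (λ i → f (suc i)) bs c m
... | t , t<c , b , e = suc t , s≤s t<c , b , e

select-applyUpTo⁺ : ∀ {A : Set} (f : ℕ → A) bs c t → bit bs t ≡ true → t < c → f t ∈ select bs (applyUpTo f c)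
select-applyUpTo⁺ f (true ∷ bs) (suc c) zero b _ = here refl
select-applyUpTo⁺ f (true ∷ bs) (suc c) (suc t) b (s≤s t<c) = there (select-applyUpTo⁺ (λ i → f (suc i)) bs c t b t<c)
select-applyUpTo⁺ f (false ∷ bs) (suc c) (suc t) b (s≤s t<c) = select-applyUpTo⁺ (λ i → f (suc i)) bs c t b t<c

merge : ℕ → List ℕ → List ℕ
merge b [] = [ b ]
merge b (a ∷ as) = (b + a) ∷ as

coarsen : List ℕ → List Bool → List ℕ
coarsen [] _ = []
coarsen (x ∷ []) _ = [ x ]
coarsen (x ∷ y ∷ ys) [] = x ∷ y ∷ ys
coarsen (x ∷ y ∷ ys) (true ∷ bs) = merge x (coarsen (y ∷ ys) bs)
coarsen (x ∷ y ∷ ys) (false ∷ bs) = x ∷ coarsen (y ∷ ys) bs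

coarsenings-↭ : ∀ x ys → coarsenings (x ∷ ys) ↭ map (coarsen (x ∷ ys)) (allBits (length ys))
coarsenings-↭ x [] = ↭-refl
coarsenings-↭ x (y ∷ ys) = begin
  coarsenings (x ∷ y ∷ ys)
    ≡⟨ cong (map (x ∷_) C ++_) (map-cong (λ { [] → refl ; (a ∷ as) → refl }) C) ⟩
  map (x ∷_) C ++ map (merge x) C
    ↭⟨ ++⁺ (map⁺ (x ∷_) ih) (map⁺ (merge x) ih) ⟩
  map (x ∷_) (map c B) ++ map (merge x) (map c B)
    ↭⟨ ++-comm (map (x ∷_) (map c B)) _ ⟩
  map (merge x) (map c B) ++ map (x ∷_) (map c B)
    ≡⟨ cong₂ _++_ (trans (sym (map-∘ B)) (map-∘ B)) (trans (sym (map-∘ B)) (map-∘ B)) ⟩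
  map (coarsen (x ∷ y ∷ ys)) (map (true ∷_) B) ++ map (coarsen (x ∷ y ∷ ys)) (map (false ∷_) B)
    ≡⟨ map-++ (coarsen (x ∷ y ∷ ys)) (map (true ∷_) B) _ ⟨
  map (coarsen (x ∷ y ∷ ys)) (allBits (length (y ∷ ys))) ∎
  where
  open Perm.PermutationReasoning
  C = coarsenings (y ∷ ys)
  c = coarsen (y ∷ ys)
  B = allBits (length ys)
  ih = coarsenings-↭ y ys

coarsen-∷ : ∀ y ys bs → ∃₂ λ c cs → coarsen (y ∷ ys) bs ≡ c ∷ cs
coarsen-∷ y [] bs = y , [] , refl
coarsen-∷ y (z ∷ zs) [] = y , z ∷ zs , refl
coarsen-∷ y (z ∷ zs) (false ∷ bs) = y , _ , refl
coarsen-∷ y (z ∷ zs) (true ∷ bs) with coarsen (z ∷ zs) bs | coarsen-∷ z zs bs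
... | .(c ∷ cs) | c , cs , refl = y + c , cs , refl

length-merge : ∀ x y ys bs → length (coarsen (x ∷ y ∷ ys) (true ∷ bs)) ≡ length (coarsen (y ∷ ys) bs)
length-merge x y ys bs with coarsen (y ∷ ys) bs | coarsen-∷ y ys bs
... | .(c ∷ cs) | c , cs , refl = refl

cut : Bool → ℕ
cut true = 0
cut false = 1

-- the index of the part of coarsen β bs containing the part i of β
block : List Bool → ℕ → ℕ
block bs zero = 0
block [] (suc i) = 0
block (b ∷ bs) (suc i) = cut b + block bs i

block-merge : ∀ bs t → bit bs t ≡ true → block bs t ≡ block bs (suc t)
block-merge (true ∷ bs) zero _ = refl
block-merge (b ∷ bs) (suc t) h = cong (cut b +_) (block-merge bs t h)

block-constant : ∀ bs {i j} → i ≤ j → j ≤ length bs → block bs i ≡ block bs j →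
                 ∀ {t} → i ≤ t → t < j → bit bs t ≡ true
block-constant bs {j = zero} _ _ _ _ ()
block-constant [] {j = suc j} _ () _ _ _
block-constant (b ∷ bs) {zero} {suc j} _ _ e {zero} _ _ = cut-0 b (m+n≡0⇒m≡0 (cut b) (sym e))
  where
  cut-0 : ∀ b → cut b ≡ 0 → b ≡ true
  cut-0 true _ = refl
block-constant (b ∷ bs) {zero} {suc j} _ (s≤s j≤) e {suc t} _ (s≤s t<j) =
  block-constant bs z≤n j≤ (sym (m+n≡0⇒n≡0 (cut b) (sym e))) z≤n t<j
block-constant (b ∷ bs) {suc i} {suc j} (s≤s i≤j) (s≤s j≤) e {suc t} (s≤s i≤t) (s≤s t<j) =
  block-constant bs i≤j j≤ (+-cancelˡ-≡ (cut b) _ _ e) i≤t t<j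

block-bound : ∀ x ys bs → length bs ≡ length ys → ∀ i → i < suc (length ys) →
              block bs i < length (coarsen (x ∷ ys) bs)
block-bound x [] bs L zero _ = s≤s z≤n
block-bound x [] bs L (suc i) (s≤s ())
block-bound x (y ∷ ys) (false ∷ bs) L zero _ = s≤s z≤n
block-bound x (y ∷ ys) (false ∷ bs) L (suc i) (s≤s p) = s≤s (block-bound y ys bs (suc-injective L) i p)
block-bound x (y ∷ ys) (true ∷ bs) L i p with i
... | zero = subst (0 <_) (sym (length-merge x y ys bs)) (block-bound y ys bs (suc-injective L) zero (s≤s z≤n))
... | suc i' = subst (block bs i' <_) (sym (length-merge x y ys bs)) (block-bound y ys bs (suc-injective L) i' (≤-pred p))

block-onto : ∀ x ys bs → length bs ≡ length ys → ∀ j → j < length (coarsen (x ∷ ys) bs) →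
             ∃ λ i → i < suc (length ys) × block bs i ≡ j
block-onto x [] bs L zero _ = 0 , s≤s z≤n , refl
block-onto x [] bs L (suc j) (s≤s ())
block-onto x (y ∷ ys) (false ∷ bs) L zero _ = 0 , s≤s z≤n , refl
block-onto x (y ∷ ys) (false ∷ bs) L (suc j) (s≤s p) with block-onto y ys bs (suc-injective L) j p
... | i , q , e = suc i , s≤s q , cong suc e
block-onto x (y ∷ ys) (true ∷ bs) L j p
  with block-onto y ys bs (suc-injective L) j (subst (j <_) (length-merge x y ys bs) p)
... | zero , q , e = 0 , s≤s z≤n , e
... | suc i , q , e = suc (suc i) , s≤s q , e

applyUpTo-cong : ∀ {f g : ℕ → ℕ} → (∀ i → f i ≡ g i) → ∀ m → applyUpTo f m ≡ applyUpTo g m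
applyUpTo-cong h zero = refl
applyUpTo-cong h (suc m) = cong₂ _∷_ (h 0) (applyUpTo-cong (λ i → h (suc i)) m)

Σ< : ℕ → (ℕ → ℕ) → ℕ
Σ< k F = sum (applyUpTo F k)

Σ<-cong : ∀ k {F G : ℕ → ℕ} → (∀ i → i < k → F i ≡ G i) → Σ< k F ≡ Σ< k G
Σ<-cong zero h = refl
Σ<-cong (suc k) h = cong₂ _+_ (h 0 (s≤s z≤n)) (Σ<-cong k (λ i p → h (suc i) (s≤s p)))

Σ<-zero : ∀ k (F : ℕ → ℕ) → (∀ i → F i ≡ 0) → Σ< k F ≡ 0
Σ<-zero zero F h = refl
Σ<-zero (suc k) F h = cong₂ _+_ (h 0) (Σ<-zero k (λ i → F (suc i)) (λ i → h (suc i)))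

Σ<-+ : ∀ k (F G : ℕ → ℕ) → Σ< k (λ i → F i + G i) ≡ Σ< k F + Σ< k G
Σ<-+ zero F G = refl
Σ<-+ (suc k) F G = trans (cong (F 0 + G 0 +_) (Σ<-+ k (λ i → F (suc i)) (λ i → G (suc i))))
                         (interchange (F 0) (G 0) _ _)

Σ<-single : ∀ k c (a : ℕ → ℕ) → c < k → Σ< k (λ i → ind (c ≡ᵇ i) (a i)) ≡ a c
Σ<-single (suc k) zero a _ = trans (cong (a 0 +_) (Σ<-zero k _ (λ _ → refl))) (+-identityʳ (a 0))
Σ<-single (suc k) (suc c) a (s≤s p) = Σ<-single k c (λ i → a (suc i)) p

at : List ℕ → ℕ → ℕ
at [] _ = 0
at (x ∷ xs) zero = x
at (x ∷ xs) (suc i) = at xs i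

blockSum : List ℕ → List Bool → ℕ → ℕ
blockSum β bs j = Σ< (length β) (λ i → ind (block bs i ≡ᵇ j) (at β i))

coarsen-blockSum : ∀ x ys bs → length bs ≡ length ys →
                   applyUpTo (blockSum (x ∷ ys) bs) (length (coarsen (x ∷ ys) bs)) ≡ coarsen (x ∷ ys) bs
coarsen-blockSum x [] bs L = cong [_] (+-identityʳ x)
coarsen-blockSum x (y ∷ ys) (false ∷ bs) L =
  cong₂ _∷_ (trans (cong (x +_) (Σ<-zero (length (y ∷ ys)) _ (λ _ → refl))) (+-identityʳ x))
            (coarsen-blockSum y ys bs (suc-injective L))
coarsen-blockSum x (y ∷ ys) (true ∷ bs) L
  with coarsen (y ∷ ys) bs | coarsen-∷ y ys bs | coarsen-blockSum y ys bs (suc-injective L)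
... | .(c ∷ cs) | c , cs , refl | ih = cong₂ _∷_ (cong (x +_) (∷-injectiveˡ ih)) (∷-injectiveʳ ih)

count-fibres : ∀ {X : Set} (sp : X → ℕ) (g : ℕ → Bool) k (xs : List X) → (∀ x → x ∈ xs → sp x < k) →
               count (λ u → g (sp u)) xs ≡ Σ< k (λ i → ind (g i) (count (λ u → sp u ≡ᵇ i) xs))
count-fibres sp g k [] h = sym (Σ<-zero k _ (λ i → ind-0 (g i)))
  where
  ind-0 : ∀ b → ind b 0 ≡ 0
  ind-0 true = refl
  ind-0 false = refl
count-fibres sp g k (x ∷ xs) h = begin
  count (λ u → g (sp u)) (x ∷ xs)
    ≡⟨ count-∷ (λ u → g (sp u)) x xs ⟩
  ind (g (sp x)) 1 + count (λ u → g (sp u)) xs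
    ≡⟨ cong₂ _+_ (sym (Σ<-single k (sp x) (λ i → ind (g i) 1) (h x (here refl))))
                 (count-fibres sp g k xs (λ y m → h y (there m))) ⟩
  Σ< k (λ i → ind (sp x ≡ᵇ i) (ind (g i) 1)) + Σ< k (λ i → ind (g i) (count (λ u → sp u ≡ᵇ i) xs))
    ≡⟨ Σ<-+ k _ _ ⟨
  Σ< k (λ i → ind (sp x ≡ᵇ i) (ind (g i) 1) + ind (g i) (count (λ u → sp u ≡ᵇ i) xs))
    ≡⟨ Σ<-cong k (λ i _ → trans (ind-swap (g i) (sp x ≡ᵇ i) _) (cong (ind (g i)) (sym (count-∷ (λ u → sp u ≡ᵇ i) x xs)))) ⟩
  Σ< k (λ i → ind (g i) (count (λ u → sp u ≡ᵇ i) (x ∷ xs))) ∎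
  where
  open ≡-Reasoning
  ind-swap : ∀ b c d → ind c (ind b 1) + ind b d ≡ ind b (ind c 1 + d)
  ind-swap true c d = refl
  ind-swap false true d = refl
  ind-swap false false d = refl

module _ {A : Set} where

  nth : A → List A → ℕ → A
  nth d [] _ = d
  nth d (x ∷ xs) zero = x
  nth d (x ∷ xs) (suc i) = nth d xs i

  nth-lookup : (d : A) (xs : List A) (i : Fin (length xs)) → nth d xs (toℕ i) ≡ lookup xs i
  nth-lookup d (x ∷ xs) fzero = refl
  nth-lookup d (x ∷ xs) (fsuc i) = nth-lookup d xs i

  nth-∈ : (d : A) (xs : List A) (i : ℕ) → i < length xs → nth d xs i ∈ xs
  nth-∈ d (x ∷ xs) zero _ = here refl
  nth-∈ d (x ∷ xs) (suc i) (s≤s p) = there (nth-∈ d xs i p)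

  at-map : (f : A → ℕ) (d : A) (xs : List A) (i : ℕ) → i < length xs → at (map f xs) i ≡ f (nth d xs i)
  at-map f d (x ∷ xs) zero _ = refl
  at-map f d (x ∷ xs) (suc i) (s≤s p) = at-map f d xs i p

module _ {n : ℕ} where

  indexOf : Fin n → List (Fin n) → ℕ
  indexOf u [] = 0
  indexOf u (x ∷ xs) = if u == x then 0 else suc (indexOf u xs)

  indexOf-∈ : (d u : Fin n) (xs : List (Fin n)) → u ∈ xs → nth d xs (indexOf u xs) ≡ u × indexOf u xs < length xs
  indexOf-∈ d u (x ∷ xs) m with u == x in e
  ... | true = sym (==-elim e) , s≤s z≤n
  indexOf-∈ d u (x ∷ xs) (here refl) | false = ⊥-elim (t≢f (trans (sym (==-refl u)) e))
  indexOf-∈ d u (x ∷ xs) (there m) | false = let (a , b) = indexOf-∈ d u xs m in a , s≤s b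

  indexOf-nth : (d : Fin n) (xs : List (Fin n)) → Unique xs → (i : ℕ) → i < length xs → indexOf (nth d xs i) xs ≡ i
  indexOf-nth d (x ∷ xs) u zero _ rewrite ==-refl x = refl
  indexOf-nth d (x ∷ xs) (x∉ ∷ u) (suc i) (s≤s p)
    rewrite ==-false {u = nth d xs i} {v = x} (λ e → All-∉ x∉ (subst (_∈ xs) e (nth-∈ d xs i p))) =
    cong suc (indexOf-nth d xs u i p)

  nth-injective : (d : Fin n) (xs : List (Fin n)) → Unique xs → ∀ {i j} → i < length xs → j < length xs →
                  nth d xs i ≡ nth d xs j → i ≡ j
  nth-injective d xs u {i} {j} p q e =
    trans (sym (indexOf-nth d xs u i p)) (trans (cong (λ z → indexOf z xs) e) (indexOf-nth d xs u j q))

  count-== : (a : Fin n) → count (λ u → u == a) (allFin n) ≡ 1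
  count-== a = unique-≈-length _ [ a ] (Unique-filter⁺ _ (allFin⁺ n)) ([] ∷ [])
    ((λ m → here (==-elim (proj₂ (filt⁻ _ (allFin n) m)))) ,
     (λ { (here refl) → filt⁺ _ (allFin n) (∈-allFin a) (==-refl a) }))

  inc : Fin n → Fin n × Fin n → Bool
  inc u e = (u == proj₁ e) ∨ (u == proj₂ e)

  inc-ends : ∀ u a b → inc u (a , b) ≡ true → u ≡ a ⊎ u ≡ b
  inc-ends u a b h with ∨-elim _ _ h
  ... | inj₁ x = inj₁ (==-elim x)
  ... | inj₂ x = inj₂ (==-elim x)

  inc-fst : ∀ u b → inc u (u , b) ≡ true
  inc-fst u b = ∨-introˡ _ _ (==-refl u)

  inc-snd : ∀ u a → inc u (a , u) ≡ true
  inc-snd u a = ∨-introʳ (u == a) _ (==-refl u)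

  other : Fin n → Fin n × Fin n → Fin n
  other u e = if u == proj₁ e then proj₂ e else proj₁ e

  other-form : ∀ u e → inc u e ≡ true → e ≡ (u , other u e) ⊎ e ≡ (other u e , u)
  other-form u (a , b) h with u == a in ea
  ... | true = inj₁ (cong (_, b) (sym (==-elim ea)))
  ... | false = inj₂ (cong (a ,_) (sym (==-elim h)))

  edge-adj : ∀ {A : Edges n} {e u w} → (e ≡ (u , w) ⊎ e ≡ (w , u)) → e ∈ A → Adj A u w
  edge-adj (inj₁ refl) m = inj₁ m
  edge-adj (inj₂ refl) m = inj₂ m

  edge-label : ∀ (f : Fin n → ℕ) {e u w} → (e ≡ (u , w) ⊎ e ≡ (w , u)) → f u ≡ f w → f (proj₁ e) ≡ f (proj₂ e)
  edge-label f (inj₁ refl) p = p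
  edge-label f (inj₂ refl) p = sym p

  inc-edge : ∀ {u e x y} → (e ≡ (x , y) ⊎ e ≡ (y , x)) → inc u e ≡ true → u ≡ x ⊎ u ≡ y
  inc-edge (inj₁ refl) h = inc-ends _ _ _ h
  inc-edge {u} {x = x} {y} (inj₂ refl) h with inc-ends u y x h
  ... | inj₁ p = inj₂ p
  ... | inj₂ p = inj₁ p

-- Anatomy of a caterpillar with spine v₀ ⋯ v_{k-1}

module Caterpillar {n : ℕ} (E : Edges n) (tree : IsTree E) (vs : List (Fin n))
                   (spine : IsSpine E vs) (proper : IsProper E) where

  k : ℕ
  k = length vs

  vs-unique : Unique vs
  vs-unique = proj₁ (proj₂ spine)

  ∈vs⇔internal : ∀ v → v ∈ vs ⇔ Internal E v
  ∈vs⇔internal = proj₁ (proj₂ (proj₂ spine))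

  V : ℕ → Fin n
  V i = nth (head vs (proj₁ spine)) vs i
    where
    head : (xs : List (Fin n)) → 2 ≤ length xs → Fin n
    head (v ∷ _) _ = v

  V-∈ : ∀ {i} → i < k → V i ∈ vs
  V-∈ {i} = nth-∈ _ vs i

  V-injective : ∀ {i j} → i < k → j < k → V i ≡ V j → i ≡ j
  V-injective = nth-injective _ vs vs-unique

  index : Fin n → ℕ
  index u = indexOf u vs

  index-V : ∀ {i} → i < k → index (V i) ≡ i
  index-V {i} = indexOf-nth _ vs vs-unique i

  V-index : ∀ {u} → u ∈ vs → V (index u) ≡ u
  V-index {u} m = proj₁ (indexOf-∈ _ u vs m)

  index-< : ∀ {u} → u ∈ vs → index u < k
  index-< {u} m = proj₂ (indexOf-∈ u u vs m)

  V-adjacent : ∀ i → suc i < k → Adj E (V i) (V (suc i))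
  V-adjacent i p = subst₂ (Adj E) (lookup-V (≤-trans (n≤1+n (suc i)) p)) (lookup-V p)
    (Equivalence.from (proj₂ (proj₂ (proj₂ spine)) (fromℕ< (≤-trans (n≤1+n (suc i)) p)) (fromℕ< p))
      (inj₁ (trans (cong suc (toℕ-fromℕ< _)) (sym (toℕ-fromℕ< p)))))
    where
    lookup-V : ∀ {j} (q : j < k) → lookup vs (fromℕ< q) ≡ V j
    lookup-V q = trans (sym (nth-lookup _ vs (fromℕ< q))) (cong V (toℕ-fromℕ< q))

  internal-V : ∀ {i} → i < k → isInternal E (V i) ≡ true
  internal-V p = ≤ᵇ-intro (Equivalence.to (∈vs⇔internal _) (V-∈ p))

  internal-∈vs : ∀ {u} → isInternal E u ≡ true → u ∈ vs
  internal-∈vs {u} h = Equivalence.from (∈vs⇔internal u) (≤ᵇ-elim h)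

  2≤k : 2 ≤ k
  2≤k = proj₁ spine

  0<k : 0 < k
  0<k = ≤-trans (s≤s z≤n) 2≤k

  adj-deg : ∀ {u w} → Adj E u w → 1 ≤ deg E u
  adj-deg {u} {w} (inj₁ m) = count-pos (inc u) E m (inc-fst u w)
  adj-deg {u} {w} (inj₂ m) = count-pos (inc u) E m (inc-snd u w)

  -- in the connected graph E with the internal vertex v₀ nothing is isolated
  deg-pos : ∀ u → 1 ≤ deg E u
  deg-pos u with u Data.Fin.≟ V 0 | proj₁ (proj₂ tree) u (V 0)
  ... | yes refl | _ = ≤-trans (n≤1+n 1) (≤ᵇ-elim (internal-V 0<k))
  ... | no u≢v₀ | here = ⊥-elim (u≢v₀ refl)
  ... | no _ | step a _ = adj-deg a

  leaf-or-internal : ∀ u → deg E u ≡ 1 ⊎ 2 ≤ deg E u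
  leaf-or-internal u with deg E u | deg-pos u
  ... | suc zero | _ = inj₁ refl
  ... | suc (suc d) | _ = inj₂ (s≤s (s≤s z≤n))

  leaf-not-internal : ∀ {u} → deg E u ≡ 1 → isInternal E u ≡ false
  leaf-not-internal {u} d = not-true (λ h → 2≰1 (subst (2 ≤_) d (≤ᵇ-elim h)))

  not-internal-leaf : ∀ {u} → isInternal E u ≡ false → deg E u ≡ 1
  not-internal-leaf {u} h with leaf-or-internal u
  ... | inj₁ d = d
  ... | inj₂ p = ⊥-elim (t≢f (trans (sym (≤ᵇ-intro p)) h))

  isLeaf≡not-isInternal : ∀ u → isLeaf E u ≡ not (isInternal E u)
  isLeaf≡not-isInternal u with isInternal E u in e
  ... | true = not-true (λ h → t≢f (trans (sym e) (leaf-not-internal {u} (≟-elim _ 1 h))))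
  ... | false = ≟-intro (not-internal-leaf {u} e)

  leafEdge : Fin n → Fin n × Fin n
  leafEdge u with filt (inc u) E
  ... | e ∷ _ = e
  ... | [] = u , u

  leafEdge-only : ∀ ℓ → deg E ℓ ≡ 1 → filt (inc ℓ) E ≡ [ leafEdge ℓ ]
  leafEdge-only ℓ d with filt (inc ℓ) E | d
  ... | e ∷ [] | _ = refl

  leafEdge-∈ : ∀ ℓ → deg E ℓ ≡ 1 → leafEdge ℓ ∈ E × inc ℓ (leafEdge ℓ) ≡ true
  leafEdge-∈ ℓ d = filt⁻ (inc ℓ) E (subst (leafEdge ℓ ∈_) (sym (leafEdge-only ℓ d)) (here refl))

  leafEdge-unique : ∀ ℓ → deg E ℓ ≡ 1 → ∀ {e} → e ∈ E → inc ℓ e ≡ true → e ≡ leafEdge ℓ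
  leafEdge-unique ℓ d m h with subst (_ ∈_) (leafEdge-only ℓ d) (filt⁺ (inc ℓ) E m h)
  ... | here p = p

  anchor : Fin n → Fin n
  anchor ℓ = other ℓ (leafEdge ℓ)

  leafEdge-form : ∀ ℓ → deg E ℓ ≡ 1 → leafEdge ℓ ≡ (ℓ , anchor ℓ) ⊎ leafEdge ℓ ≡ (anchor ℓ , ℓ)
  leafEdge-form ℓ d = other-form ℓ (leafEdge ℓ) (proj₂ (leafEdge-∈ ℓ d))

  adj-anchor : ∀ {ℓ y} → deg E ℓ ≡ 1 → Adj E ℓ y → y ≡ anchor ℓ
  adj-anchor {ℓ} {y} d (inj₁ m) with leafEdge-form ℓ d | leafEdge-unique ℓ d m (inc-fst ℓ y)
  ... | inj₁ f | q = cong proj₂ (trans q f)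
  ... | inj₂ f | q = trans (cong proj₂ (trans q f)) (cong proj₁ (trans q f))
  adj-anchor {ℓ} {y} d (inj₂ m) with leafEdge-form ℓ d | leafEdge-unique ℓ d m (inc-snd ℓ y)
  ... | inj₁ f | q = trans (cong proj₁ (trans q f)) (cong proj₂ (trans q f))
  ... | inj₂ f | q = cong proj₁ (trans q f)

  -- the anchor of a leaf is internal: otherwise the edge ℓ ─ anchor ℓ
  -- would be a whole component, missing v₀
  anchor-internal : ∀ ℓ → deg E ℓ ≡ 1 → 2 ≤ deg E (anchor ℓ)
  anchor-internal ℓ d with leaf-or-internal (anchor ℓ)
  ... | inj₂ p = p
  ... | inj₁ dw = ⊥-elim (v₀∉ (closed (inj₁ refl) (proj₁ (proj₂ tree) ℓ (V 0))))
    where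
    w = anchor ℓ
    back : ℓ ≡ anchor w
    back = adj-anchor dw (adj-sym (edge-adj (leafEdge-form ℓ d) (proj₁ (leafEdge-∈ ℓ d))))
    closed : ∀ {x y} → (x ≡ ℓ ⊎ x ≡ w) → Reach E x y → (y ≡ ℓ ⊎ y ≡ w)
    closed h here = h
    closed (inj₁ refl) (step a r) = closed (inj₂ (adj-anchor d a)) r
    closed (inj₂ refl) (step a r) = closed (inj₁ (trans (adj-anchor dw a) (sym back))) r
    v₀∉ : ¬ (V 0 ≡ ℓ ⊎ V 0 ≡ w)
    v₀∉ (inj₁ e) = t≢f (trans (sym (internal-V 0<k)) (subst (λ z → isInternal E z ≡ false) (sym e) (leaf-not-internal {ℓ} d)))
    v₀∉ (inj₂ e) = t≢f (trans (sym (internal-V 0<k)) (subst (λ z → isInternal E z ≡ false) (sym e) (leaf-not-internal {w} dw)))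

  anchor-∈vs : ∀ {ℓ} → deg E ℓ ≡ 1 → anchor ℓ ∈ vs
  anchor-∈vs {ℓ} d = internal-∈vs (≤ᵇ-intro (anchor-internal ℓ d))

  spinePosOf : Bool → Fin n → ℕ
  spinePosOf true u = index u
  spinePosOf false u = index (anchor u)

  spinePos : Fin n → ℕ
  spinePos u = spinePosOf (isInternal E u) u

  spinePos-internal : ∀ {u} → isInternal E u ≡ true → spinePos u ≡ index u
  spinePos-internal {u} h = cong (λ b → spinePosOf b u) h

  spinePos-leaf : ∀ {u} → deg E u ≡ 1 → spinePos u ≡ index (anchor u)
  spinePos-leaf {u} d = cong (λ b → spinePosOf b u) (leaf-not-internal {u} d)

  spinePos-< : ∀ u → spinePos u < k
  spinePos-< u with isInternal E u in e
  ... | true = index-< (internal-∈vs e)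
  ... | false = index-< (anchor-∈vs (not-internal-leaf {u} e))

  spinePos-V : ∀ {i} → i < k → spinePos (V i) ≡ i
  spinePos-V p = trans (spinePos-internal (internal-V p)) (index-V p)

  V-spinePos-internal : ∀ {u} → isInternal E u ≡ true → V (spinePos u) ≡ u
  V-spinePos-internal {u} h = trans (cong V (spinePos-internal h)) (V-index (internal-∈vs h))

  V-spinePos-leaf : ∀ {u} → deg E u ≡ 1 → V (spinePos u) ≡ anchor u
  V-spinePos-leaf {u} d = trans (cong V (spinePos-leaf d)) (V-index (anchor-∈vs d))

  spinePos-anchor : ∀ ℓ → deg E ℓ ≡ 1 → spinePos ℓ ≡ spinePos (anchor ℓ)
  spinePos-anchor ℓ d = trans (spinePos-leaf d) (sym (spinePos-internal (≤ᵇ-intro (anchor-internal ℓ d))))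

  leaves : List (Fin n)
  leaves = filt (isLeaf E) (allFin n)

  leaves-leaf : ∀ {ℓ} → ℓ ∈ leaves → deg E ℓ ≡ 1
  leaves-leaf {ℓ} m = ≟-elim _ 1 (proj₂ (filt⁻ _ (allFin n) m))

  internals-count : count (isInternal E) (allFin n) ≡ k
  internals-count = unique-≈-length _ vs (Unique-filter⁺ _ (allFin⁺ n)) vs-unique
    ((λ m → internal-∈vs (proj₂ (filt⁻ _ (allFin n) m))) ,
     (λ {u} m → filt⁺ _ (allFin n) (∈-allFin u) (≤ᵇ-intro (Equivalence.to (∈vs⇔internal u) m))))

  vertex-count : n ≡ k + length leaves
  vertex-count = trans (sym (length-tabulate (λ x → x)))
    (trans (filt-length (isInternal E) (allFin n))
      (cong₂ _+_ internals-count (cong length (filt-cong _ _ (λ u → sym (isLeaf≡not-isInternal u)) (allFin n)))))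

  bothInternal : Fin n × Fin n → Bool
  bothInternal e = isInternal E (proj₁ e) ∧ isInternal E (proj₂ e)

  LE : Edges n
  LE = leafEdges E

  internalEdges : Edges n
  internalEdges = filt bothInternal E

  leaf-end : ∀ {e} → e ∈ E → not (bothInternal e) ≡ true → ∃ λ ℓ → deg E ℓ ≡ 1 × inc ℓ e ≡ true
  leaf-end {a , b} m h with isInternal E a in ea
  ... | false = a , not-internal-leaf {a} ea , inc-fst a b
  ... | true with isInternal E b in eb
  ...   | false = b , not-internal-leaf {b} eb , inc-snd b a

  leaf-edge : ∀ {e ℓ} → deg E ℓ ≡ 1 → inc ℓ e ≡ true → not (bothInternal e) ≡ true
  leaf-edge {a , b} {ℓ} d h with inc-ends ℓ a b h
  ... | inj₁ refl rewrite leaf-not-internal {ℓ} d = refl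
  ... | inj₂ refl rewrite leaf-not-internal {ℓ} d with isInternal E a
  ...   | true = refl
  ...   | false = refl

  -- distinct leaves have distinct leaf edges (the other end is internal)
  leafEdge-injective : ∀ {ℓ ℓ'} → deg E ℓ ≡ 1 → deg E ℓ' ≡ 1 → leafEdge ℓ ≡ leafEdge ℓ' → ℓ ≡ ℓ'
  leafEdge-injective {ℓ} {ℓ'} d d' e
    with inc-edge (leafEdge-form ℓ d) (subst (λ z → inc ℓ' z ≡ true) (sym e) (proj₂ (leafEdge-∈ ℓ' d')))
  ... | inj₁ p = sym p
  ... | inj₂ p = ⊥-elim (2≰1 (subst (2 ≤_) (subst (λ z → deg E z ≡ 1) p d') (anchor-internal ℓ d)))

  gaps : ℕ
  gaps = Data.Nat.pred k

  suc-gaps : suc gaps ≡ k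
  suc-gaps with k | 0<k
  ... | suc _ | _ = refl

  gap-< : ∀ {i} → i < gaps → suc i < k
  gap-< p = subst (_ <_) suc-gaps (s≤s p)

  -- the spine edge v_i ─ v_{i+1}, oriented as it occurs in E
  spineEdge : ℕ → Fin n × Fin n
  spineEdge i = if memB (V i , V (suc i)) E then (V i , V (suc i)) else (V (suc i) , V i)

  spineEdge-form : ∀ i → spineEdge i ≡ (V i , V (suc i)) ⊎ spineEdge i ≡ (V (suc i) , V i)
  spineEdge-form i with memB (V i , V (suc i)) E
  ... | true = inj₁ refl
  ... | false = inj₂ refl

  spineEdge-∈ : ∀ i → suc i < k → spineEdge i ∈ E
  spineEdge-∈ i p with memB (V i , V (suc i)) E in e
  ... | true = memB⁻ _ E e
  ... | false with V-adjacent i p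
  ...   | inj₁ m = ⊥-elim (t≢f (trans (sym (memB⁺ _ E m)) e))
  ...   | inj₂ m = m

  spineEdge-internal : ∀ i → suc i < k → bothInternal (spineEdge i) ≡ true
  spineEdge-internal i p with spineEdge-form i
  ... | inj₁ f rewrite f = ∧-intro (internal-V (≤-trans (n≤1+n _) p)) (internal-V p)
  ... | inj₂ f rewrite f = ∧-intro (internal-V p) (internal-V (≤-trans (n≤1+n _) p))

  spineEdge-injective : ∀ {i j} → suc i < k → suc j < k → spineEdge i ≡ spineEdge j → i ≡ j
  spineEdge-injective {i} {j} p q e with spineEdge-form i | spineEdge-form j
  ... | inj₁ a | inj₁ b = V-injective (≤-trans (n≤1+n _) p) (≤-trans (n≤1+n _) q) (cong proj₁ (trans (sym a) (trans e b)))
  ... | inj₂ a | inj₂ b = V-injective (≤-trans (n≤1+n _) p) (≤-trans (n≤1+n _) q) (cong proj₂ (trans (sym a) (trans e b)))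
  ... | inj₁ a | inj₂ b = ⊥-elim (no-2-cycle
        (V-injective (≤-trans (n≤1+n _) p) q (cong proj₁ (trans (sym a) (trans e b))))
        (V-injective p (≤-trans (n≤1+n _) q) (cong proj₂ (trans (sym a) (trans e b)))))
    where
    no-2-cycle : i ≡ suc j → suc i ≡ j → ⊥
    no-2-cycle refl ()
  ... | inj₂ a | inj₁ b = ⊥-elim (no-2-cycle
        (V-injective p (≤-trans (n≤1+n _) q) (cong proj₁ (trans (sym a) (trans e b))))
        (V-injective (≤-trans (n≤1+n _) p) q (cong proj₂ (trans (sym a) (trans e b)))))
    where
    no-2-cycle : suc i ≡ j → i ≡ suc j → ⊥
    no-2-cycle refl ()

  spineEdges : Edges n
  spineEdges = applyUpTo spineEdge gaps

  spineEdges-unique : Unique spineEdges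
  spineEdges-unique = applyUpTo⁺₁ spineEdge gaps
    (λ i<j j<gaps e → <-irrefl (spineEdge-injective (gap-< (<-trans i<j j<gaps)) (gap-< j<gaps) e) i<j)

  spineEdges-⊆ : spineEdges ⊆ internalEdges
  spineEdges-⊆ m with ∈-applyUpTo⁻ spineEdge m
  ... | i , i<gaps , refl = filt⁺ bothInternal E (spineEdge-∈ i (gap-< i<gaps)) (spineEdge-internal i (gap-< i<gaps))

  -- Counting edges: |E| = n - 1 forces L(T) ≅ leaves and internal edges = spine edges

  leafEdges-⊇ : map leafEdge leaves ⊆ LE
  leafEdges-⊇ m with ∈-map⁻ leafEdge m
  ... | ℓ , mℓ , refl = filt⁺ _ E (proj₁ (leafEdge-∈ ℓ (leaves-leaf mℓ)))
                          (leaf-edge {leafEdge ℓ} {ℓ} (leaves-leaf mℓ) (proj₂ (leafEdge-∈ ℓ (leaves-leaf mℓ))))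

  leafEdges-of-leaves-unique : Unique (map leafEdge leaves)
  leafEdges-of-leaves-unique = unique-map leafEdge leaves (Unique-filter⁺ _ (allFin⁺ n))
    (λ mx my → leafEdge-injective (leaves-leaf mx) (leaves-leaf my))

  -- |leaves| ≤ |L(T)| and gaps ≤ |internal edges|, while the sum of both sides is |E| = n - 1
  edge-count : length LE ≤ length leaves × length internalEdges ≤ gaps
  edge-count = squeeze
    (subst (_≤ length LE) (length-map leafEdge leaves)
      (unique-⊆-length _ LE leafEdges-of-leaves-unique leafEdges-⊇))
    (subst (_≤ length internalEdges) (length-applyUpTo spineEdge gaps)
      (unique-⊆-length _ _ spineEdges-unique spineEdges-⊆))
    (suc-injective (begin
      suc (length leaves + gaps)   ≡⟨ cong suc (+-comm (length leaves) gaps) ⟩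
      suc gaps + length leaves     ≡⟨ cong (_+ length leaves) suc-gaps ⟩
      k + length leaves            ≡⟨ vertex-count ⟨
      n                            ≡⟨ proj₂ (proj₂ tree) ⟨
      suc (length E)               ≡⟨ cong suc (filt-length bothInternal E) ⟩
      suc (length internalEdges + length LE) ≡⟨ cong suc (+-comm (length internalEdges) _) ⟩
      suc (length LE + length internalEdges) ∎))
    where open ≡-Reasoning

  LE-unique : Unique LE
  LE-unique = PermSetoid.Unique-resp-↭ (setoid _) (↭⇒↭ₛ (↭-sym LE-↭)) leafEdges-of-leaves-unique
    where
    LE-↭ : LE ↭ map leafEdge leaves
    LE-↭ = unique-⊆-↭ _ LE leafEdges-of-leaves-unique leafEdges-⊇
      (subst (length LE ≤_) (sym (length-map leafEdge leaves)) (proj₁ edge-count))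

  E-↭ : E ↭ LE ++ spineEdges
  E-↭ = ↭-trans (filt-partition bothInternal E) (++⁺ˡ LE internalEdges-↭)
    where
    internalEdges-↭ : internalEdges ↭ spineEdges
    internalEdges-↭ = unique-⊆-↭ spineEdges internalEdges spineEdges-unique spineEdges-⊆
      (subst (length internalEdges ≤_) (sym (length-applyUpTo spineEdge gaps)) (proj₂ edge-count))

  LE-disjoint : ∀ {e} → e ∈ LE → e ∉ spineEdges
  LE-disjoint mL mS = t≢f (sym (subst (λ b → not b ≡ true)
    (proj₂ (filt⁻ bothInternal E (spineEdges-⊆ mS))) (proj₂ (filt⁻ _ E mL))))

  internal-fibre : ∀ {i} → i < k → count (λ u → (spinePos u ≡ᵇ i) ∧ isInternal E u) (allFin n) ≡ 1
  internal-fibre {i} p = trans (cong length (filt-cong _ _ is-V (allFin n))) (count-== (V i))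
    where
    is-V : ∀ u → ((spinePos u ≡ᵇ i) ∧ isInternal E u) ≡ (u == V i)
    is-V u = bool-ext _ _
      (λ h → let (a , b) = ∧-elim _ _ h in ==-intro (trans (sym (V-spinePos-internal b)) (cong V (≡ᵇ-elim a))))
      (λ h → subst (λ z → ((spinePos z ≡ᵇ i) ∧ isInternal E z) ≡ true) (sym (==-elim h))
               (∧-intro (≡ᵇ-intro (spinePos-V p)) (internal-V p)))

  leafAt : Fin n → Fin n × Fin n → Bool
  leafAt v e = ((v == proj₁ e) ∧ isLeaf E (proj₂ e)) ∨ ((v == proj₂ e) ∧ isLeaf E (proj₁ e))

  leafAt-leafEdge : ∀ ℓ → deg E ℓ ≡ 1 → leafAt (anchor ℓ) (leafEdge ℓ) ≡ true
  leafAt-leafEdge ℓ d = edge-to-leaf (leafEdge-form ℓ d)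
    where
    edge-to-leaf : ∀ {a e} → (e ≡ (ℓ , a) ⊎ e ≡ (a , ℓ)) → leafAt a e ≡ true
    edge-to-leaf {a} (inj₁ refl) = ∨-introʳ _ _ (∧-intro (==-refl a) (≟-intro d))
    edge-to-leaf {a} (inj₂ refl) = ∨-introˡ _ _ (∧-intro (==-refl a) (≟-intro d))

  leafAt-elim : ∀ {v e} → e ∈ E → leafAt v e ≡ true → ∃ λ ℓ → deg E ℓ ≡ 1 × v ≡ anchor ℓ × e ≡ leafEdge ℓ
  leafAt-elim {v} {a , b} m h with ∨-elim ((v == a) ∧ isLeaf E b) _ h
  ... | inj₁ h' = let (x , y) = ∧-elim (v == a) _ h' ; d = ≟-elim _ 1 y in
        b , d , trans (==-elim x) (adj-anchor d (inj₂ m)) , leafEdge-unique b d m (inc-snd b a)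
  ... | inj₂ h' = let (x , y) = ∧-elim (v == b) _ h' ; d = ≟-elim _ 1 y in
        a , d , trans (==-elim x) (adj-anchor d (inj₁ m)) , leafEdge-unique a d m (inc-fst a b)

  -- the leaves at spine position i correspond, via their leaf edges, to the
  -- edges counted by leafCount E (V i)
  leaf-fibre : ∀ {i} → i < k → count (λ u → (spinePos u ≡ᵇ i) ∧ not (isInternal E u)) (allFin n) ≡ leafCount E (V i)
  leaf-fibre {i} p = trans (sym (length-map leafEdge hanging))
    (unique-≈-length _ _ hanging-unique edgesAt-unique (edges-⊆ , edges-⊇))
    where
    hanging = filt (λ u → (spinePos u ≡ᵇ i) ∧ not (isInternal E u)) (allFin n)
    edgesAt = filt (leafAt (V i)) E

    hanging⁻ : ∀ {ℓ} → ℓ ∈ hanging → deg E ℓ ≡ 1 × anchor ℓ ≡ V i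
    hanging⁻ {ℓ} m with ∧-elim _ _ (proj₂ (filt⁻ _ (allFin n) m))
    ... | a , b = let d = not-internal-leaf {ℓ} (trans (sym (not-involutive _)) (cong not b)) in
                  d , trans (sym (V-spinePos-leaf d)) (cong V (≡ᵇ-elim a))

    hanging⁺ : ∀ ℓ → deg E ℓ ≡ 1 → anchor ℓ ≡ V i → ℓ ∈ hanging
    hanging⁺ ℓ d e = filt⁺ _ (allFin n) (∈-allFin ℓ)
      (∧-intro (≡ᵇ-intro (V-injective (spinePos-< ℓ) p (trans (V-spinePos-leaf d) e))) (cong not (leaf-not-internal {ℓ} d)))

    hanging-unique : Unique (map leafEdge hanging)
    hanging-unique = unique-map leafEdge hanging (Unique-filter⁺ _ (allFin⁺ n))
      (λ mx my → leafEdge-injective (proj₁ (hanging⁻ mx)) (proj₁ (hanging⁻ my)))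

    -- edgesAt consists of leaf edges, so it is a sublist of the duplicate-free LE
    edgesAt-unique : Unique edgesAt
    edgesAt-unique = subst Unique (sym (filt-filt (leafAt (V i)) (λ e → not (bothInternal e)) E leaf-edge-of))
                       (Unique-filter⁺ _ LE-unique)
      where
      leaf-edge-of : ∀ e → leafAt (V i) e ≡ true → not (bothInternal e) ≡ true
      leaf-edge-of (a , b) h with ∨-elim ((V i == a) ∧ isLeaf E b) _ h
      ... | inj₁ h' = leaf-edge {a , b} {b} (≟-elim _ 1 (proj₂ (∧-elim (V i == a) _ h'))) (inc-snd b a)
      ... | inj₂ h' = leaf-edge {a , b} {a} (≟-elim _ 1 (proj₂ (∧-elim (V i == b) _ h'))) (inc-fst a b)

    edges-⊆ : map leafEdge hanging ⊆ edgesAt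
    edges-⊆ m with ∈-map⁻ leafEdge m
    ... | ℓ , mℓ , refl = let (d , e) = hanging⁻ mℓ in
          filt⁺ _ E (proj₁ (leafEdge-∈ ℓ d)) (subst (λ v → leafAt v (leafEdge ℓ) ≡ true) e (leafAt-leafEdge ℓ d))

    edges-⊇ : edgesAt ⊆ map leafEdge hanging
    edges-⊇ m with filt⁻ _ E m
    ... | mE , h with leafAt-elim mE h
    ... | ℓ , d , v≡ , refl = ∈-map⁺ leafEdge (hanging⁺ ℓ d (sym v≡))

  fibre-size : ∀ {i} → i < k → count (λ u → spinePos u ≡ᵇ i) (allFin n) ≡ suc (leafCount E (V i))
  fibre-size p = trans (count-split _ (isInternal E) (allFin n)) (cong₂ _+_ (internal-fibre p) (leaf-fibre p))

  -- v₀ has a leaf neighbour, so there is a vertex off the spine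
  k<n : k < n
  k<n with proper (V 0) (≤ᵇ-elim (internal-V 0<k))
  ... | u , d , _ = subst (k <_) (sym vertex-count) (m<m+n k (count-pos _ (allFin n) (∈-allFin u) (≟-intro d)))

-- The components of L(T) ++ (the spine edges selected by a bit vector)

module Components {n : ℕ} (E : Edges n) (tree : IsTree E) (vs : List (Fin n))
                  (spine : IsSpine E vs) (proper : IsProper E)
                  (x : ℕ) (ys : List ℕ) (β≡ : x ∷ ys ≡ map (λ v → suc (leafCount E v)) vs) where

  open Caterpillar E tree vs spine proper

  suc-length-ys : suc (length ys) ≡ k
  suc-length-ys = trans (cong length β≡) (length-map _ vs)

  length-ys : length ys ≡ gaps
  length-ys = suc-injective (trans suc-length-ys (sym suc-gaps))

  at-β : ∀ {i} → i < k → at (x ∷ ys) i ≡ suc (leafCount E (V i))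
  at-β {i} p = trans (cong (λ l → at l i) β≡) (at-map _ _ vs i p)

  module ForBits (bs : List Bool) (length-bs : length bs ≡ gaps) where

    A : Edges n
    A = LE ++ select bs spineEdges

    label : Fin n → ℕ
    label u = block bs (spinePos u)

    m : ℕ
    m = length (coarsen (x ∷ ys) bs)

    ≤gaps : ∀ {i} → i < k → i ≤ gaps
    ≤gaps p = ≤-pred (subst (_ <_) (sym suc-gaps) p)

    label-bound : ∀ u → label u < m
    label-bound u = block-bound x ys bs (trans length-bs (sym length-ys)) (spinePos u)
                      (subst (spinePos u <_) (sym suc-length-ys) (spinePos-< u))

    label-onto : ∀ j → j < m → ∃ λ u → label u ≡ j
    label-onto j p with block-onto x ys bs (trans length-bs (sym length-ys)) j p
    ... | i , q , e = V i , trans (cong (block bs) (spinePos-V (subst (i <_) suc-length-ys q))) e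

    label-edge : ∀ {e} → e ∈ A → label (proj₁ e) ≡ label (proj₂ e)
    label-edge {e} me with ∈-++⁻ LE me
    ... | inj₁ mL with filt⁻ _ E mL
    ...   | mE , h with leaf-end mE h
    ...     | ℓ , d , inc-ℓ rewrite leafEdge-unique ℓ d mE inc-ℓ =
              edge-label label (leafEdge-form ℓ d) (cong (block bs) (spinePos-anchor ℓ d))
    label-edge {e} me | inj₂ mS with select-applyUpTo⁻ spineEdge bs gaps mS
    ... | t , t<gaps , merged , refl =
          edge-label label (spineEdge-form t)
            (trans (cong (block bs) (spinePos-V (<-trans (n<1+n t) (gap-< t<gaps))))
              (trans (block-merge bs t merged) (cong (block bs) (sym (spinePos-V (gap-< t<gaps))))))

    to-spine : ∀ w → ∃ λ d → d ≤ 1 × Walk A d (V (spinePos w)) w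
    to-spine w with isInternal E w in e
    ... | true = 0 , z≤n , subst (λ z → Walk A 0 z w) (sym (V-index (internal-∈vs e))) nil
    ... | false = 1 , ≤-refl ,
          snoc nil (subst (λ z → Adj A z w) (sym (V-index (anchor-∈vs d)))
                     (adj-sym (edge-adj (leafEdge-form w d) (∈-++⁺ˡ leafEdge-LE))))
      where
      d = not-internal-leaf {w} e
      leafEdge-LE : leafEdge w ∈ LE
      leafEdge-LE = filt⁺ _ E (proj₁ (leafEdge-∈ w d)) (leaf-edge {leafEdge w} {w} d (proj₂ (leafEdge-∈ w d)))

    spine-walk : ∀ i j → i ≤ j → j < k → (∀ {t} → i ≤ t → t < j → bit bs t ≡ true) →
                 ∃ λ d → d ≤ j × Walk A d (V i) (V j)
    spine-walk i zero z≤n p h = 0 , z≤n , nil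
    spine-walk i (suc j) i≤j p h with m≤n⇒m<n∨m≡n i≤j
    ... | inj₂ refl = 0 , z≤n , nil
    ... | inj₁ (s≤s i≤j') with spine-walk i j i≤j' (<-trans (n<1+n j) p) (λ a b → h a (<-trans b (n<1+n j)))
    ...   | d , d≤j , walk = suc d , s≤s d≤j , snoc walk next
      where
      selected : spineEdge j ∈ A
      selected = ∈-++⁺ʳ LE (select-applyUpTo⁺ spineEdge bs gaps j (h i≤j' ≤-refl) (≤gaps p))
      next : Adj A (V j) (V (suc j))
      next = edge-adj (spineEdge-form j) selected

    -- a walk leaf → spine → spine → leaf has length ≤ k + 1 ≤ n
    bound : ∀ {d₁ d₂ d₃} → d₁ ≤ 1 → d₂ ≤ gaps → d₃ ≤ 1 → d₁ + d₂ + d₃ ≤ n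
    bound p q r = ≤-trans (+-mono-≤ (+-mono-≤ p q) r)
      (subst (_≤ n) (cong suc (trans (sym suc-gaps) (+-comm 1 gaps))) k<n)

    label-walk : ∀ u v → label u ≡ label v → ∃ λ d → d ≤ n × Walk A d v u
    label-walk u v same with to-spine v | to-spine u | ≤-total (spinePos v) (spinePos u)
    ... | d₁ , d₁≤1 , w₁ | d₃ , d₃≤1 , w₃ | inj₁ v≤u
      with spine-walk _ _ v≤u (spinePos-< u) (block-constant bs v≤u (≤-trans (≤gaps (spinePos-< u)) (≤-reflexive (sym length-bs))) (sym same))
    ...   | d₂ , d₂≤ , w₂ = _ , bound d₁≤1 (≤-trans d₂≤ (≤gaps (spinePos-< u))) d₃≤1 , walk-++ (walk-++ (walk-reverse w₁) w₂) w₃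
    label-walk u v same | d₁ , d₁≤1 , w₁ | d₃ , d₃≤1 , w₃ | inj₂ u≤v
      with spine-walk _ _ u≤v (spinePos-< v) (block-constant bs u≤v (≤-trans (≤gaps (spinePos-< v)) (≤-reflexive (sym length-bs))) same)
    ...   | d₂ , d₂≤ , w₂ = _ , bound d₁≤1 (≤-trans d₂≤ (≤gaps (spinePos-< v))) d₃≤1 , walk-++ (walk-++ (walk-reverse w₁) (walk-reverse w₂)) w₃

    open Labelling A label m label-bound label-onto label-edge label-walk

    fibreSize≡blockSum : ∀ j → fibreSize j ≡ blockSum (x ∷ ys) bs j
    fibreSize≡blockSum j = begin
      count (λ u → block bs (spinePos u) ≡ᵇ j) (allFin n)
        ≡⟨ count-fibres spinePos (λ i → block bs i ≡ᵇ j) k (allFin n) (λ u _ → spinePos-< u) ⟩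
      Σ< k (λ i → ind (block bs i ≡ᵇ j) (count (λ u → spinePos u ≡ᵇ i) (allFin n)))
        ≡⟨ Σ<-cong k (λ i p → cong (ind (block bs i ≡ᵇ j)) (trans (fibre-size p) (sym (at-β p)))) ⟩
      Σ< k (λ i → ind (block bs i ≡ᵇ j) (at (x ∷ ys) i))
        ≡⟨ cong (λ l → Σ< l (λ i → ind (block bs i ≡ᵇ j) (at (x ∷ ys) i))) suc-length-ys ⟨
      blockSum (x ∷ ys) bs j ∎
      where open ≡-Reasoning

    typeOf-A : typeOf A ≡ sort (coarsen (x ∷ ys) bs)
    typeOf-A = begin
      sort (componentSizes A)                          ≡⟨ sort-↭-≡ _ _ componentSizes-↭ ⟩
      sort (applyUpTo fibreSize m)                     ≡⟨ cong sort (applyUpTo-cong fibreSize≡blockSum m) ⟩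
      sort (applyUpTo (blockSum (x ∷ ys) bs) m)        ≡⟨ cong sort (coarsen-blockSum x ys bs (trans length-bs (sym length-ys))) ⟩
      sort (coarsen (x ∷ ys) bs) ∎
      where open ≡-Reasoning

  UL-↭ : UL E ↭ Lpoly (x ∷ ys)
  UL-↭ = begin
    over typeOf (contains LE) E
      ↭⟨ over-↭ typeOf (contains LE) typeOf-≈ (contains-≈ LE) E-↭ ⟩
    over typeOf (contains LE) (LE ++ spineEdges)
      ≡⟨ over-prefix LE spineEdges LE-unique LE-disjoint typeOf ⟩
    map (λ T → typeOf (LE ++ T)) (subsets spineEdges)
      ≡⟨ cong (map (λ T → typeOf (LE ++ T))) (subsets-select spineEdges) ⟩
    map (λ T → typeOf (LE ++ T)) (map (λ bs → select bs spineEdges) (allBits (length spineEdges)))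
      ≡⟨ cong (λ l → map (λ T → typeOf (LE ++ T)) (map (λ bs → select bs spineEdges) (allBits l)))
              (trans (length-applyUpTo spineEdge gaps) (sym length-ys)) ⟩
    map (λ T → typeOf (LE ++ T)) (map (λ bs → select bs spineEdges) (allBits (length ys)))
      ≡⟨ map-∘ (allBits (length ys)) ⟨
    map (λ bs → typeOf (LE ++ select bs spineEdges)) (allBits (length ys))
      ≡⟨ map-cong-local (tabulate (λ {bs} m → ForBits.typeOf-A bs (trans (allBits-length _ m) length-ys))) ⟩
    map (λ bs → sort (coarsen (x ∷ ys) bs)) (allBits (length ys))
      ≡⟨ map-∘ (allBits (length ys)) ⟩
    map sort (map (coarsen (x ∷ ys)) (allBits (length ys)))
      ↭⟨ map⁺ sort (↭-sym (coarsenings-↭ x ys)) ⟩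
    Lpoly (x ∷ ys) ∎
    where open Perm.PermutationReasoning

proposition2p3 : (n : ℕ) (E : Edges n) → IsCaterpillar E → IsProper E
                 → (β : List ℕ) → InΦ E β → UL E ↭ Lpoly β
proposition2p3 n E (tree , _) proper [] ([] , (() , _) , _)
proposition2p3 n E (tree , _) proper (x ∷ ys) (vs , spine , β≡) = Components.UL-↭ E tree vs spine proper x ys β≡
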